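{- Let $p$ be a prime. The distance Laplacian characteristic polynomial of the power graph $\mathcal{P}(\mathbb{Z}_{p}\times \mathbb{Z}_{p} \times \mathbb{Z}_{p})$ is, up to the sign $(-1)^{p^3}$, \[ x(x-p^{3})(x-2p^{3}+1)^{p^{2}+p}(x-2p^{3}+p)^{p^{3}-p^{2}-p-2}; \] equivalently, $\det(xI-D^L)$ equals this polynomial, where $D^L$ is the distance Laplacian matrix of this power graph.
   Context: $\mathbb{Z}_m$ denotes the cyclic group of integers modulo $m$. The (undirected) power graph $\mathcal{P}(\mathcal{G})$ of a finite group $\mathcal{G}$ has vertex set $\mathcal{G}$, and two distinct elements $x,y$ are adjacent iff $y=x^{i}$ or $x=y^{j}$ for some positive integers $i,j$. For a connected graph $G$ with vertices $v_1,\dots,v_n$, $D(G)=(d(v_i,v_j))$ is the distance matrix, $Tr(v_i)=\sum_j d(v_i,v_j)$ is the transmission of $v_i$, $Tr(G)=\mathrm{diag}(Tr(v_1),\dots,Tr(v_n))$, and the distance Laplacian matrix is $D^L(G)=Tr(G)-D(G)$. The paper defines the distance Laplacian characteristic polynomial as $\det(D^L(G)-xI_n)$. -}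

module Defs where

open import Data.Nat as ℕ using (ℕ; zero; suc; NonZero)
open import Data.Nat.DivMod using (_/_; _%_)
open import Data.Integer as ℤ using (ℤ; +_)
open import Data.Fin using (Fin; zero; suc; punchIn)
open import Data.Fin.Properties using (_≟_)
open import Data.Product using (_×_; ∃)
open import Data.Sum using (_⊎_)
open import Relation.Binary.PropositionalEquality using (_≡_; _≢_)
open import Relation.Nullary using (does)
open import Data.Bool using (if_then_else_)

∑ : (n : ℕ) → (Fin n → ℤ) → ℤ
∑ zero    f = + 0
∑ (suc n) f = f zero ℤ.+ ∑ n (λ j → f (suc j))

sgn : ℕ → ℤ
sgn zero    = + 1
sgn (suc k) = ℤ.- sgn k

det : (n : ℕ) → (Fin n → Fin n → ℤ) → ℤ
det zero    M = + 1
det (suc n) M =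
  ∑ (suc n) (λ j → sgn (Data.Fin.toℕ j) ℤ.* M zero j
                    ℤ.* det n (λ r c → M (suc r) (punchIn j c)))

-- Elements of Z_p × Z_p × Z_p are triples of naturals < p
Triple : Set
Triple = ℕ × ℕ × ℕ

order : ℕ → ℕ
order p = p ℕ.* p ℕ.* p

module PowerGraph (p : ℕ) .{{_ : NonZero p}} where

  N : ℕ
  N = order p

  -- vertex with index k ∈ Fin (p^3) is the group element (k mod p, ⌊k/p⌋ mod p, ⌊k/p²⌋ mod p);
  -- this is a bijection Fin (p^3) ≃ Z_p^3
  elem : Fin N → Triple
  elem k = let n = Data.Fin.toℕ k in
    Data.Product._,_ (n % p) (Data.Product._,_ ((n / p) % p) ((n / p / p) % p))

  -- x^i in the additive group Z_p^3 is i·x (componentwise mod p)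
  pow : Triple → ℕ → Triple
  pow (Data.Product._,_ a (Data.Product._,_ b c)) i =
    Data.Product._,_ ((i ℕ.* a) % p) (Data.Product._,_ ((i ℕ.* b) % p) ((i ℕ.* c) % p))

  Adj : Fin N → Fin N → Set
  Adj u v = u ≢ v × ((∃ λ i → elem v ≡ pow (elem u) (suc i))
                   ⊎ (∃ λ j → elem u ≡ pow (elem v) (suc j)))

  data Walk : Fin N → Fin N → ℕ → Set where
    here  : ∀ {u} → Walk u u 0
    there : ∀ {u v w k} → Adj u v → Walk v w k → Walk u w (suc k)

  IsDistance : (Fin N → Fin N → ℕ) → Set
  IsDistance d = ∀ u v → Walk u v (d u v) × (∀ k → Walk u v k → d u v ℕ.≤ k)

  Tr : (Fin N → Fin N → ℕ) → Fin N → ℤ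
  Tr d u = ∑ N (λ v → + d u v)

  δ : Fin N → Fin N → ℤ → ℤ
  δ u v a = if does (u ≟ v) then a else + 0

  DL : (Fin N → Fin N → ℕ) → Fin N → Fin N → ℤ
  DL d u v = δ u v (Tr d u) ℤ.- + d u v

  charMat : (Fin N → Fin N → ℕ) → ℤ → Fin N → Fin N → ℤ
  charMat d x u v = δ u v x ℤ.- DL d u v

claimedPoly : ℕ → ℤ → ℤ
claimedPoly p x =
  let q = + order p in
  x ℤ.* (x ℤ.- q)
    ℤ.* ((x ℤ.- + 2 ℤ.* q ℤ.+ + 1) ℤ.^ (p ℕ.* p ℕ.+ p))
    ℤ.* ((x ℤ.- + 2 ℤ.* q ℤ.+ + p) ℤ.^ (order p ℕ.∸ p ℕ.* p ℕ.∸ p ℕ.∸ 2))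

-- Write xI − D^L as a quotient matrix Q(σ, ω)ᵢⱼ = δᵢⱼ A(σᵢ) + F(σᵢ, σⱼ) ωⱼ with σ = id and unit
-- weights ω.  If two representatives are twins (the same diagonal value α and equal rows and columns
-- of F), one row and one column operation give det Q = α · det Q′, where Q′ merges the two and adds
-- their weights.
-- In the power graph of ℤₚ³ distinct elements are at distance 1 when one lies in the cyclic subgroup
-- generated by the other (always so for the identity e) and at distance 2 otherwise.  Non-identity
-- elements generating the same subgroup are therefore twins with α = x − 2p³ + p; merging them leaves
-- e and the p² + p + 1 lines of ℤₚ³, each of weight p − 1.  On these classes the diagonal can be
-- rewritten so that all line classes become twins with α = x − 2p³ + 1, and the remaining 2 × 2
-- determinant is x(x − p³).

module Submission where

open import Defs
open import Data.Nat using (ℕ)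
open import Data.Nat.Primality using (Prime; prime⇒nonZero)
open import Data.Integer using (ℤ)
open import Data.Fin using (Fin)
open import Relation.Binary.PropositionalEquality using (_≡_)

module FinSum where

  open import Data.Nat.Base using (zero; suc)
  open import Data.Integer.Base using (+_; _+_; _*_; -_; _-_)
  open import Data.Bool.Base using (if_then_else_)
  open import Data.Product.Base using (∃-syntax; _,_)
  import Data.Integer.Properties as ℤ
  open import Data.Fin.Base using (zero; suc; punchIn)
  open import Data.Fin.Properties using (_≟_; suc-injective; punchInᵢ≢i; punchIn-injective)
  open import Function.Definitions using (Injective)
  open import Relation.Nullary.Negation using (contradiction)
  open import Function.Base using (_∘_; flip)
  open import Relation.Binary.PropositionalEquality
  open import Relation.Nullary.Negation using (¬_)
  open import Relation.Nullary.Decidable using (Dec; yes; no; does; ¬?; _×-dec_; dec-true; dec-false)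
  open import Relation.Unary using (Pred; Decidable)
  import Algebra.Properties.Semiring.Sum ℤ.+-*-semiring as Sum

  toFront : ∀ {n} → Fin (suc n) → Fin (suc n) → Fin (suc n)
  toFront u zero    = u
  toFront u (suc r) = punchIn u r

  toFront-injective : ∀ {n} (u : Fin (suc n)) → Injective _≡_ _≡_ (toFront u)
  toFront-injective u {zero}  {zero}  _  = refl
  toFront-injective u {zero}  {suc j} eq = contradiction (sym eq) (punchInᵢ≢i u j)
  toFront-injective u {suc i} {zero}  eq = contradiction eq (punchInᵢ≢i u i)
  toFront-injective u {suc i} {suc j} eq = cong suc (punchIn-injective u i j eq)

  ∑≡sum : ∀ n (f : Fin n → ℤ) → ∑ n f ≡ Sum.sum f
  ∑≡sum zero    f = refl
  ∑≡sum (suc n) f = cong (_+_ (f zero)) (∑≡sum n (f ∘ suc))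

  ∑-cong : ∀ n {f g : Fin n → ℤ} → (∀ j → f j ≡ g j) → ∑ n f ≡ ∑ n g
  ∑-cong zero    f≗g = refl
  ∑-cong (suc n) f≗g = cong₂ _+_ (f≗g zero) (∑-cong n (f≗g ∘ suc))

  ∑-zero : ∀ n {f : Fin n → ℤ} → (∀ j → f j ≡ + 0) → ∑ n f ≡ + 0
  ∑-zero zero    f≗0 = refl
  ∑-zero (suc n) f≗0 = cong₂ _+_ (f≗0 zero) (∑-zero n (f≗0 ∘ suc))

  ∑-const : ∀ n c → ∑ n (λ _ → c) ≡ + n * c
  ∑-const zero    c = sym (ℤ.*-zeroˡ c)
  ∑-const (suc n) c = begin
    c + ∑ n (λ _ → c)  ≡⟨ cong (_+_ c) (∑-const n c) ⟩
    c + + n * c        ≡⟨ cong (_+ + n * c) (ℤ.*-identityˡ c) ⟨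
    + 1 * c + + n * c  ≡⟨ ℤ.*-distribʳ-+ c (+ 1) (+ n) ⟨
    + suc n * c        ∎
    where open ≡-Reasoning

  ∑-single : ∀ n (f : Fin n → ℤ) w → (∀ j → ¬ j ≡ w → f j ≡ + 0) → ∑ n f ≡ f w
  ∑-single (suc n) f zero    f≗0 =
    trans (cong (_+_ (f zero)) (∑-zero n (λ j → f≗0 (suc j) (λ ())))) (ℤ.+-identityʳ _)
  ∑-single (suc n) f (suc w) f≗0 =
    trans (cong (_+ ∑ n (f ∘ suc)) (f≗0 zero (λ ()))) (trans (ℤ.+-identityˡ _)
          (∑-single n (f ∘ suc) w (λ j j≢w → f≗0 (suc j) (j≢w ∘ suc-injective))))

  ∑-distrib-+ : ∀ n (f g : Fin n → ℤ) → ∑ n (λ j → f j + g j) ≡ ∑ n f + ∑ n g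
  ∑-distrib-+ n f g = begin
    ∑ n (λ j → f j + g j)      ≡⟨ ∑≡sum n _ ⟩
    Sum.sum (λ j → f j + g j)  ≡⟨ Sum.∑-distrib-+ f g ⟩
    Sum.sum f + Sum.sum g      ≡⟨ cong₂ _+_ (∑≡sum n f) (∑≡sum n g) ⟨
    ∑ n f + ∑ n g              ∎
    where open ≡-Reasoning

  neg-distrib-∑ : ∀ n (f : Fin n → ℤ) → - ∑ n f ≡ ∑ n (λ j → - f j)
  neg-distrib-∑ zero    f = refl
  neg-distrib-∑ (suc n) f =
    trans (ℤ.neg-distrib-+ (f zero) _) (cong (_+_ (- f zero)) (neg-distrib-∑ n (f ∘ suc)))

  ∑-distrib-minus : ∀ n (f g : Fin n → ℤ) → ∑ n (λ j → f j - g j) ≡ ∑ n f - ∑ n g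
  ∑-distrib-minus n f g =
    trans (∑-distrib-+ n f (λ j → - g j)) (cong (_+_ (∑ n f)) (sym (neg-distrib-∑ n g)))

  *-distribˡ-∑ : ∀ n c (f : Fin n → ℤ) → c * ∑ n f ≡ ∑ n (λ j → c * f j)
  *-distribˡ-∑ n c f = begin
    c * ∑ n f                  ≡⟨ cong (c *_) (∑≡sum n f) ⟩
    c * Sum.sum f              ≡⟨ Sum.*-distribˡ-sum c f ⟩
    Sum.sum (λ j → c * f j)    ≡⟨ ∑≡sum n _ ⟨
    ∑ n (λ j → c * f j)        ∎
    where open ≡-Reasoning

  ∑-remove : ∀ n (f : Fin (suc n) → ℤ) u → ∑ (suc n) f ≡ f u + ∑ n (f ∘ punchIn u)
  ∑-remove n f u = begin
    ∑ (suc n) f                      ≡⟨ ∑≡sum (suc n) f ⟩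
    Sum.sum f                        ≡⟨ Sum.sum-remove f ⟩
    f u + Sum.sum (f ∘ punchIn u)    ≡⟨ cong (_+_ (f u)) (∑≡sum n _) ⟨
    f u + ∑ n (f ∘ punchIn u)        ∎
    where open ≡-Reasoning

  ∑-comm : ∀ m n (f : Fin m → Fin n → ℤ) →
           ∑ m (λ i → ∑ n (f i)) ≡ ∑ n (λ j → ∑ m (λ i → f i j))
  ∑-comm m n f = begin
    ∑ m (λ i → ∑ n (f i))                    ≡⟨ ∑≡sum² m n f ⟩
    Sum.sum (λ i → Sum.sum (f i))            ≡⟨ Sum.∑-comm f ⟩
    Sum.sum (λ j → Sum.sum (λ i → f i j))    ≡⟨ ∑≡sum² n m (flip f) ⟨
    ∑ n (λ j → ∑ m (λ i → f i j))            ∎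
    where
    open ≡-Reasoning
    ∑≡sum² : ∀ m n (f : Fin m → Fin n → ℤ) →
             ∑ m (λ i → ∑ n (f i)) ≡ Sum.sum (λ i → Sum.sum (f i))
    ∑≡sum² m n f = trans (∑≡sum m _) (Sum.sum-cong-≗ (λ i → ∑≡sum n (f i)))

  ∑-toFront : ∀ n (f : Fin (suc n) → ℤ) u → ∑ (suc n) (f ∘ toFront u) ≡ ∑ (suc n) f
  ∑-toFront n f u = sym (∑-remove n f u)

  𝟙 : ∀ {A : Set} → Dec A → ℤ
  𝟙 a? = if does a? then + 1 else + 0

  𝟙-yes : ∀ {A : Set} (a? : Dec A) → A → 𝟙 a? ≡ + 1
  𝟙-yes a? a = cong (λ b → if b then + 1 else + 0) (dec-true a? a)

  𝟙-no : ∀ {A : Set} (a? : Dec A) → ¬ A → 𝟙 a? ≡ + 0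
  𝟙-no a? ¬a = cong (λ b → if b then + 1 else + 0) (dec-false a? ¬a)

  𝟙-×-¬ : ∀ {A B : Set} (a? : Dec A) (b? : Dec B) → (B → A) → 𝟙 (a? ×-dec ¬? b?) ≡ 𝟙 a? - 𝟙 b?
  𝟙-×-¬ (yes a) (yes b) B⇒A = refl
  𝟙-×-¬ (yes a) (no ¬b) B⇒A = refl
  𝟙-×-¬ (no ¬a) (yes b) B⇒A = contradiction (B⇒A b) ¬a
  𝟙-×-¬ (no ¬a) (no ¬b) B⇒A = refl

  δ : ∀ {n} → Fin n → Fin n → ℤ → ℤ
  δ i j a = if does (i ≟ j) then a else + 0

  δ-refl : ∀ {n} (i : Fin n) a → δ i i a ≡ a
  δ-refl i a with i ≟ i
  ... | yes _   = refl
  ... | no  i≢i = contradiction refl i≢i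

  δ-≢ : ∀ {n} {i j : Fin n} a → ¬ i ≡ j → δ i j a ≡ + 0
  δ-≢ {i = i} {j} a i≢j with i ≟ j
  ... | yes i≡j = contradiction i≡j i≢j
  ... | no  _   = refl

  δ-injective : ∀ {m n} {f : Fin m → Fin n} → Injective _≡_ _≡_ f → ∀ i j a → δ (f i) (f j) a ≡ δ i j a
  δ-injective {f = f} f-inj i j a with i ≟ j
  ... | yes refl = δ-refl (f i) a
  ... | no  i≢j  = δ-≢ a (i≢j ∘ f-inj)

  ∑-δˡ : ∀ n (i : Fin n) a → ∑ n (λ j → δ i j a) ≡ a
  ∑-δˡ n i a = trans (∑-single n (λ j → δ i j a) i (λ j j≢i → δ-≢ a (j≢i ∘ sym))) (δ-refl i a)

  ∑-δʳ : ∀ n (j : Fin n) a → ∑ n (λ i → δ i j a) ≡ a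
  ∑-δʳ n j a = trans (∑-single n (λ i → δ i j a) j (λ i → δ-≢ a)) (δ-refl j a)

  ∑-𝟙-image : ∀ {m n} (f : Fin m → Fin n) → Injective _≡_ _≡_ f →
    {P : Pred (Fin n) _} (P? : Decidable P) → (∀ {v} → P v → ∃[ t ] v ≡ f t) → (∀ t → P (f t)) →
    ∑ n (λ v → 𝟙 (P? v)) ≡ + m
  ∑-𝟙-image {m} {n} f f-inj P? P⇒image image⇒P = begin
      ∑ n (λ v → 𝟙 (P? v))
    ≡⟨ ∑-cong n multiplicity ⟨
      ∑ n (λ v → ∑ m (λ t → δ v (f t) (+ 1)))
    ≡⟨ ∑-comm n m (λ v t → δ v (f t) (+ 1)) ⟩
      ∑ m (λ t → ∑ n (λ v → δ v (f t) (+ 1)))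
    ≡⟨ ∑-cong m (λ t → ∑-δʳ n (f t) (+ 1)) ⟩
      ∑ m (λ _ → + 1)
    ≡⟨ ∑-const m (+ 1) ⟩
      + m * + 1
    ≡⟨ ℤ.*-identityʳ (+ m) ⟩
      + m
    ∎
    where
    open ≡-Reasoning
    multiplicity : ∀ v → ∑ m (λ t → δ v (f t) (+ 1)) ≡ 𝟙 (P? v)
    multiplicity v with P? v
    ... | yes Pv with P⇒image Pv
    ...   | t₀ , refl = trans (∑-cong m (λ t → δ-injective f-inj t₀ t (+ 1))) (∑-δˡ m t₀ (+ 1))
    multiplicity v | no ¬Pv = ∑-zero m (λ t → δ-≢ {i = v} {f t} (+ 1) (λ { refl → ¬Pv (image⇒P t) }))

module Determinant where

  open FinSum
  open import Data.Nat.Base using (zero; suc)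
  open import Data.Integer.Base using (+_; -[1+_]; _+_; _*_; -_; _-_)
  import Data.Integer.Properties as ℤ
  open import Data.Integer.Tactic.RingSolver using (solve-∀)
  open import Data.Fin.Base using (zero; suc; punchIn; toℕ)
  open import Function.Base using (_∘_)
  open import Data.Vec.Functional using (updateAt)
  open import Relation.Binary.PropositionalEquality

  Matrix : ℕ → Set
  Matrix n = Fin n → Fin n → ℤ

  minor : ∀ {n} → Matrix (suc n) → Fin (suc n) → Fin (suc n) → Matrix n
  minor M i j r c = M (punchIn i r) (punchIn j c)

  transpose : ∀ {n} → Matrix n → Matrix n
  transpose M i j = M j i

  swap₀₁ : ∀ {n} → Fin (suc (suc n)) → Fin (suc (suc n))
  swap₀₁ = toFront (suc zero)

  x≡-x⇒x≡0 : ∀ {x} → x ≡ - x → x ≡ + 0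
  x≡-x⇒x≡0 {+ zero}    _  = refl
  x≡-x⇒x≡0 {+ suc n}   ()
  x≡-x⇒x≡0 { -[1+ n ]} ()

  sgn-cancel : ∀ k x → sgn k * (sgn k * x) ≡ x
  sgn-cancel zero    x = trans (ℤ.*-identityˡ _) (ℤ.*-identityˡ x)
  sgn-cancel (suc k) x = trans (neg² (sgn k) x) (sgn-cancel k x)
    where neg² : ∀ s x → - s * (- s * x) ≡ s * (s * x)
          neg² = solve-∀

  det-cong : ∀ n {M N : Matrix n} → (∀ i j → M i j ≡ N i j) → det n M ≡ det n N
  det-cong zero    M≗N = refl
  det-cong (suc n) M≗N = ∑-cong (suc n) λ j →
    cong₂ (λ a b → sgn (toℕ j) * a * b) (M≗N zero j) (det-cong n (λ r c → M≗N (suc r) (punchIn j c)))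

  cofactor₀ : ∀ {n} → Matrix (suc n) → Fin (suc n) → ℤ
  cofactor₀ {n} M i = sgn (toℕ i) * M i zero * det n (minor M i zero)

  det-expand-col₀ : ∀ n (M : Matrix (suc n)) → det (suc n) M ≡ ∑ (suc n) (cofactor₀ M)
  det-expand-col₀ zero    M = refl
  det-expand-col₀ (suc n) M = cong (_+_ (cofactor₀ M zero)) (begin
      ∑ (suc n) (λ j → - s j * M zero (suc j) * det (suc n) (minor M zero (suc j)))
    ≡⟨ ∑-cong (suc n) (λ j → cong (_*_ (- s j * M zero (suc j))) (det-expand-col₀ n (minor M zero (suc j)))) ⟩
      ∑ (suc n) (λ j → - s j * M zero (suc j) * ∑ (suc n) (λ i → s i * M (suc i) zero * D i j))
    ≡⟨ ∑-cong (suc n) (λ j → *-distribˡ-∑ (suc n) (- s j * M zero (suc j)) (λ i → s i * M (suc i) zero * D i j)) ⟩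
      ∑ (suc n) (λ j → ∑ (suc n) (λ i → - s j * M zero (suc j) * (s i * M (suc i) zero * D i j)))
    ≡⟨ ∑-comm (suc n) (suc n) (λ j i → - s j * M zero (suc j) * (s i * M (suc i) zero * D i j)) ⟩
      ∑ (suc n) (λ i → ∑ (suc n) (λ j → - s j * M zero (suc j) * (s i * M (suc i) zero * D i j)))
    ≡⟨ ∑-cong (suc n) (λ i → ∑-cong (suc n) (λ j → exchange (s j) (s i) (M zero (suc j)) (M (suc i) zero) (D i j))) ⟩
      ∑ (suc n) (λ i → ∑ (suc n) (λ j → - s i * M (suc i) zero * (s j * M zero (suc j) * D i j)))
    ≡⟨ ∑-cong (suc n) (λ i → *-distribˡ-∑ (suc n) (- s i * M (suc i) zero) (λ j → s j * M zero (suc j) * D i j)) ⟨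
      ∑ (suc n) (cofactor₀ M ∘ suc)
    ∎)
    where
    open ≡-Reasoning
    s : Fin (suc n) → ℤ
    s i = sgn (toℕ i)
    D : Fin (suc n) → Fin (suc n) → ℤ
    D i j = det n (minor (minor M (suc i) zero) zero j)
    exchange : ∀ sj si a b d → - sj * a * (si * b * d) ≡ - si * b * (sj * a * d)
    exchange = solve-∀

  det-transpose : ∀ n (M : Matrix n) → det n (transpose M) ≡ det n M
  det-transpose zero    M = refl
  det-transpose (suc n) M = trans
    (∑-cong (suc n) (λ i → cong (_*_ (sgn (toℕ i) * M i zero)) (det-transpose n (minor M i zero))))
    (sym (det-expand-col₀ n M))

  det-swap₀₁ : ∀ n (M : Matrix (suc (suc n))) → det (suc (suc n)) (M ∘ swap₀₁) ≡ - det (suc (suc n)) M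
  cofactor₀-swap₀₁ : ∀ n (M : Matrix (suc (suc n))) i → cofactor₀ (M ∘ swap₀₁) i ≡ - cofactor₀ M (swap₀₁ i)

  det-swap₀₁ n M = begin
    det (suc (suc n)) (M ∘ swap₀₁)            ≡⟨ det-expand-col₀ (suc n) (M ∘ swap₀₁) ⟩
    ∑ (suc (suc n)) (cofactor₀ (M ∘ swap₀₁))  ≡⟨ ∑-cong (suc (suc n)) (cofactor₀-swap₀₁ n M) ⟩
    ∑ (suc (suc n)) (λ i → - cofactor₀ M (swap₀₁ i))
                                              ≡⟨ neg-distrib-∑ (suc (suc n)) (cofactor₀ M ∘ swap₀₁) ⟨
    - ∑ (suc (suc n)) (cofactor₀ M ∘ swap₀₁)  ≡⟨ cong -_ (∑-toFront (suc n) (cofactor₀ M) (suc zero)) ⟩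
    - ∑ (suc (suc n)) (cofactor₀ M)           ≡⟨ cong -_ (det-expand-col₀ (suc n) M) ⟨
    - det (suc (suc n)) M                     ∎
    where open ≡-Reasoning

  cofactor₀-swap₀₁ n M zero = flipSign (M (suc zero) zero) (det (suc n) (minor M (suc zero) zero))
    where flipSign : ∀ a d → + 1 * a * d ≡ - (- + 1 * a * d)
          flipSign = solve-∀
  cofactor₀-swap₀₁ n M (suc zero) = trans
    (cong (- + 1 * M zero zero *_) (det-cong (suc n) {minor (M ∘ swap₀₁) (suc zero) zero} {minor M zero zero}
                                              λ { zero c → refl ; (suc r) c → refl }))
    (flipSign (M zero zero) (det (suc n) (minor M zero zero)))
    where flipSign : ∀ a d → - + 1 * a * d ≡ - (+ 1 * a * d)
          flipSign = solve-∀
  cofactor₀-swap₀₁ (suc n) M (suc (suc i)) = begin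
      s * det (suc (suc n)) (minor (M ∘ swap₀₁) (suc (suc i)) zero)
    ≡⟨ cong (s *_) (det-cong (suc (suc n)) {minor (M ∘ swap₀₁) (suc (suc i)) zero} {minor M (suc (suc i)) zero ∘ swap₀₁}
                              λ { zero c → refl ; (suc zero) c → refl ; (suc (suc r)) c → refl }) ⟩
      s * det (suc (suc n)) (minor M (suc (suc i)) zero ∘ swap₀₁)
    ≡⟨ cong (s *_) (det-swap₀₁ n (minor M (suc (suc i)) zero)) ⟩
      s * - det (suc (suc n)) (minor M (suc (suc i)) zero)
    ≡⟨ ℤ.neg-distribʳ-* s (det (suc (suc n)) (minor M (suc (suc i)) zero)) ⟨
      - cofactor₀ M (suc (suc i))
    ∎
    where
    open ≡-Reasoning
    s : ℤ
    s = sgn (toℕ (suc (suc i))) * M (suc (suc i)) zero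

  det-equalRows₀₁ : ∀ n (M : Matrix (suc (suc n))) → (∀ j → M zero j ≡ M (suc zero) j) → det (suc (suc n)) M ≡ + 0
  det-equalRows₀₁ n M row₀≡row₁ = x≡-x⇒x≡0 (trans
    (det-cong (suc (suc n)) {M} {M ∘ swap₀₁}
      λ { zero j → row₀≡row₁ j ; (suc zero) j → sym (row₀≡row₁ j) ; (suc (suc i)) j → refl })
    (det-swap₀₁ n M))

  det-rowsToFront : ∀ n (u : Fin (suc n)) (M : Matrix (suc n)) → det (suc n) (M ∘ toFront u) ≡ sgn (toℕ u) * det (suc n) M
  det-rowsToFront n       zero    M = trans
    (det-cong (suc n) {M ∘ toFront zero} {M} λ { zero c → refl ; (suc r) c → refl })
    (sym (ℤ.*-identityˡ (det (suc n) M)))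
  det-rowsToFront (suc n) (suc u) M = begin
      det (suc (suc n)) (M ∘ toFront (suc u))
    ≡⟨ det-cong (suc (suc n)) {M ∘ toFront (suc u)} {N ∘ swap₀₁}
                (λ { zero c → refl ; (suc zero) c → refl ; (suc (suc r)) c → refl }) ⟩
      det (suc (suc n)) (N ∘ swap₀₁)
    ≡⟨ det-swap₀₁ n N ⟩
      - det (suc (suc n)) N
    ≡⟨ cong -_ (∑-cong (suc (suc n)) λ j → cong (_*_ (sgn (toℕ j) * M zero j)) (det-rowsToFront n u (minor M zero j))) ⟩
      - ∑ (suc (suc n)) (λ j → sgn (toℕ j) * M zero j * (sgn (toℕ u) * det (suc n) (minor M zero j)))
    ≡⟨ cong -_ (∑-cong (suc (suc n)) λ j → pull (sgn (toℕ j) * M zero j) (sgn (toℕ u)) (det (suc n) (minor M zero j))) ⟩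
      - ∑ (suc (suc n)) (λ j → sgn (toℕ u) * (sgn (toℕ j) * M zero j * det (suc n) (minor M zero j)))
    ≡⟨ cong -_ (*-distribˡ-∑ (suc (suc n)) (sgn (toℕ u)) (λ j → sgn (toℕ j) * M zero j * det (suc n) (minor M zero j))) ⟨
      - (sgn (toℕ u) * det (suc (suc n)) M)
    ≡⟨ ℤ.neg-distribˡ-* (sgn (toℕ u)) _ ⟩
      sgn (toℕ (suc u)) * det (suc (suc n)) M
    ∎
    where
    open ≡-Reasoning
    N : Matrix (suc (suc n))
    N zero    = M zero
    N (suc r) = M (suc (toFront u r))
    pull : ∀ a s d → a * (s * d) ≡ s * (a * d)
    pull = solve-∀

  det-conjugate-toFront : ∀ n (u : Fin (suc n)) (M : Matrix (suc n)) →
    det (suc n) (λ i j → M (toFront u i) (toFront u j)) ≡ det (suc n) M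
  det-conjugate-toFront n u M = begin
      det (suc n) (λ i j → M (toFront u i) (toFront u j))
    ≡⟨ det-rowsToFront n u (λ i j → M i (toFront u j)) ⟩
      sgn (toℕ u) * det (suc n) (λ i j → M i (toFront u j))
    ≡⟨ cong (_*_ (sgn (toℕ u))) (det-transpose (suc n) (λ i j → M i (toFront u j))) ⟨
      sgn (toℕ u) * det (suc n) (transpose M ∘ toFront u)
    ≡⟨ cong (_*_ (sgn (toℕ u))) (det-rowsToFront n u (transpose M)) ⟩
      sgn (toℕ u) * (sgn (toℕ u) * det (suc n) (transpose M))
    ≡⟨ sgn-cancel (toℕ u) (det (suc n) (transpose M)) ⟩
      det (suc n) (transpose M)
    ≡⟨ det-transpose (suc n) M ⟩
      det (suc n) M
    ∎
    where open ≡-Reasoning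

  det-addRow₀ : ∀ n c (M : Matrix (suc (suc n))) →
    det (suc (suc n)) (updateAt M zero (λ r j → r j + c * M (suc zero) j)) ≡ det (suc (suc n)) M
  det-addRow₀ n c M = begin
      ∑ (suc (suc n)) (λ j → s j * (M zero j + c * M (suc zero) j) * D j)
    ≡⟨ ∑-cong (suc (suc n)) (λ j → split (s j) (M zero j) c (M (suc zero) j) (D j)) ⟩
      ∑ (suc (suc n)) (λ j → s j * M zero j * D j + c * (s j * M (suc zero) j * D j))
    ≡⟨ ∑-distrib-+ (suc (suc n)) (λ j → s j * M zero j * D j) (λ j → c * (s j * M (suc zero) j * D j)) ⟩
      det (suc (suc n)) M + ∑ (suc (suc n)) (λ j → c * (s j * M (suc zero) j * D j))
    ≡⟨ cong (_+_ (det (suc (suc n)) M)) (*-distribˡ-∑ (suc (suc n)) c (λ j → s j * M (suc zero) j * D j)) ⟨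
      det (suc (suc n)) M + c * det (suc (suc n)) (updateAt M zero (λ _ → M (suc zero)))
    ≡⟨ cong (λ x → det (suc (suc n)) M + c * x) (det-equalRows₀₁ n (updateAt M zero (λ _ → M (suc zero))) (λ _ → refl)) ⟩
      det (suc (suc n)) M + c * + 0
    ≡⟨ cong (_+_ (det (suc (suc n)) M)) (ℤ.*-zeroʳ c) ⟩
      det (suc (suc n)) M + + 0
    ≡⟨ ℤ.+-identityʳ (det (suc (suc n)) M) ⟩
      det (suc (suc n)) M
    ∎
    where
    open ≡-Reasoning
    s : Fin (suc (suc n)) → ℤ
    s j = sgn (toℕ j)
    D : Fin (suc (suc n)) → ℤ
    D j = det (suc n) (minor M zero j)
    split : ∀ s a c b d → s * (a + c * b) * d ≡ s * a * d + c * (s * b * d)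
    split = solve-∀

  det-addRow₁ : ∀ n c (M : Matrix (suc (suc n))) →
    det (suc (suc n)) (updateAt M (suc zero) (λ r j → r j + c * M zero j)) ≡ det (suc (suc n)) M
  det-addRow₁ n c M = begin
      det (suc (suc n)) M′
    ≡⟨ ℤ.neg-involutive (det (suc (suc n)) M′) ⟨
      - - det (suc (suc n)) M′
    ≡⟨ cong -_ (det-swap₀₁ n M′) ⟨
      - det (suc (suc n)) (M′ ∘ swap₀₁)
    ≡⟨ cong -_ (det-cong (suc (suc n)) {M′ ∘ swap₀₁} {updateAt (M ∘ swap₀₁) zero (λ r j → r j + c * M zero j)}
                 λ { zero j → refl ; (suc zero) j → refl ; (suc (suc i)) j → refl }) ⟩
      - det (suc (suc n)) (updateAt (M ∘ swap₀₁) zero (λ r j → r j + c * M zero j))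
    ≡⟨ cong -_ (det-addRow₀ n c (M ∘ swap₀₁)) ⟩
      - det (suc (suc n)) (M ∘ swap₀₁)
    ≡⟨ cong -_ (det-swap₀₁ n M) ⟩
      - - det (suc (suc n)) M
    ≡⟨ ℤ.neg-involutive (det (suc (suc n)) M) ⟩
      det (suc (suc n)) M
    ∎
    where
    open ≡-Reasoning
    M′ : Matrix (suc (suc n))
    M′ = updateAt M (suc zero) (λ r j → r j + c * M zero j)

  det-addCol₁ : ∀ n c (M : Matrix (suc (suc n))) →
    det (suc (suc n)) (λ i → updateAt (M i) (suc zero) (λ x → x + c * M i zero)) ≡ det (suc (suc n)) M
  det-addCol₁ n c M = begin
      det (suc (suc n)) M′
    ≡⟨ det-transpose (suc (suc n)) M′ ⟨
      det (suc (suc n)) (transpose M′)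
    ≡⟨ det-cong (suc (suc n)) {transpose M′} {updateAt (transpose M) (suc zero) (λ r j → r j + c * M j zero)}
                (λ { zero j → refl ; (suc zero) j → refl ; (suc (suc i)) j → refl }) ⟩
      det (suc (suc n)) (updateAt (transpose M) (suc zero) (λ r j → r j + c * M j zero))
    ≡⟨ det-addRow₁ n c (transpose M) ⟩
      det (suc (suc n)) (transpose M)
    ≡⟨ det-transpose (suc (suc n)) M ⟩
      det (suc (suc n)) M
    ∎
    where
    open ≡-Reasoning
    M′ : Matrix (suc (suc n))
    M′ i = updateAt (M i) (suc zero) (λ x → x + c * M i zero)

  det-row₀-single : ∀ n (M : Matrix (suc n)) → (∀ j → M zero (suc j) ≡ + 0) →
    det (suc n) M ≡ M zero zero * det n (minor M zero zero)
  det-row₀-single n M row₀≡0 = begin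
      + 1 * M zero zero * det n (minor M zero zero) + ∑ n (term ∘ suc)
    ≡⟨ cong₂ _+_ (cong (_* det n (minor M zero zero)) (ℤ.*-identityˡ (M zero zero))) (∑-zero n vanish) ⟩
      M zero zero * det n (minor M zero zero) + + 0
    ≡⟨ ℤ.+-identityʳ _ ⟩
      M zero zero * det n (minor M zero zero)
    ∎
    where
    open ≡-Reasoning
    term : Fin (suc n) → ℤ
    term j = sgn (toℕ j) * M zero j * det n (minor M zero j)
    vanish : ∀ j → term (suc j) ≡ + 0
    vanish j = begin
      sgn (toℕ (suc j)) * M zero (suc j) * det n (minor M zero (suc j))  ≡⟨ cong (λ m → sgn (toℕ (suc j)) * m * det n (minor M zero (suc j))) (row₀≡0 j) ⟩
      sgn (toℕ (suc j)) * + 0 * det n (minor M zero (suc j))             ≡⟨ cong (_* det n (minor M zero (suc j))) (ℤ.*-zeroʳ (sgn (toℕ (suc j)))) ⟩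
      + 0 * det n (minor M zero (suc j))                                 ≡⟨ ℤ.*-zeroˡ (det n (minor M zero (suc j))) ⟩
      + 0                                                                ∎

  det₂ : ∀ (M : Matrix 2) → det 2 M ≡ M zero zero * M (suc zero) (suc zero) - M zero (suc zero) * M (suc zero) zero
  det₂ M = expand (M zero zero) (M zero (suc zero)) (M (suc zero) zero) (M (suc zero) (suc zero))
    where expand : ∀ a b c d → + 1 * a * (+ 1 * d * + 1 + + 0) + (- + 1 * b * (+ 1 * c * + 1 + + 0) + + 0) ≡ a * d - b * c
          expand = solve-∀

module QuotientMatrix where

  open FinSum
  open Determinant
  open import Data.Nat.Base using (zero; suc; _+_)
  open import Data.Integer.Base using (+_; _*_; -_; _-_; _^_) renaming (_+_ to _⊕_)
  import Data.Integer.Properties as ℤ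
  open import Data.Integer.Tactic.RingSolver using (solve-∀)
  open import Data.Fin.Base using (zero; suc; punchOut)
  open import Data.Fin.Properties using (_≟_; suc-injective; punchIn-punchOut; any?)
  open import Data.Product.Base using (∃-syntax; _×_; _,_)
  open import Data.Vec.Functional using (updateAt)
  open import Function.Base using (_∘_)
  open import Function.Definitions using (Injective)
  open import Relation.Binary.PropositionalEquality
  open import Relation.Nullary.Decidable using (Dec; yes; no; ¬?; _×-dec_)
  open import Relation.Nullary.Negation using (¬_; contradiction)

  module _ {V : Set} (A : V → ℤ) (F : V → V → ℤ) where

    quotient : ∀ {k} → (Fin k → V) → (Fin k → ℤ) → Matrix k
    quotient σ ω i j = δ i j (A (σ i)) ⊕ F (σ i) (σ j) * ω j

    record Twins (α : ℤ) (x y : V) : Set where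
      field
        diagˡ : A x ≡ α
        diagʳ : A y ≡ α
        row   : ∀ z → F x z ≡ F y z
        col   : ∀ z → F z x ≡ F z y

    det-quotient-toFront : ∀ n (σ : Fin (suc n) → V) ω u →
      det (suc n) (quotient (σ ∘ toFront u) (ω ∘ toFront u)) ≡ det (suc n) (quotient σ ω)
    det-quotient-toFront n σ ω u = trans
      (det-cong (suc n) λ i j → cong (_⊕ F (σ (toFront u i)) (σ (toFront u j)) * ω (toFront u j))
                                     (sym (δ-injective (toFront-injective u) i j (A (σ (toFront u i))))))
      (det-conjugate-toFront n u (quotient σ ω))

    merge₀₁ : ∀ {n} → (Fin (suc (suc n)) → ℤ) → Fin (suc n) → ℤ
    merge₀₁ ω zero    = ω (suc zero) ⊕ ω zero
    merge₀₁ ω (suc j) = ω (suc (suc j))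

    -- Row 0 minus row 1 is α(e₀ − e₁); adding column 0 to column 1 then leaves α e₀ in row 0,
    -- and the new column 1 carries the merged weight ω₀ + ω₁.
    det-quotient-merge₀₁ : ∀ n (σ : Fin (suc (suc n)) → V) ω {α} → Twins α (σ zero) (σ (suc zero)) →
      det (suc (suc n)) (quotient σ ω) ≡ α * det (suc n) (quotient (σ ∘ suc) (merge₀₁ ω))
    det-quotient-merge₀₁ n σ ω {α} twins = begin
        det (suc (suc n)) Q
      ≡⟨ det-addRow₀ n (- + 1) Q ⟨
        det (suc (suc n)) R
      ≡⟨ det-addCol₁ n (+ 1) R ⟨
        det (suc (suc n)) S
      ≡⟨ det-row₀-single (suc n) S S₀ ⟩
        R zero zero * det (suc n) (minor S zero zero)
      ≡⟨ cong₂ _*_ R₀₀ (det-cong (suc n) minor-S) ⟩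
        α * det (suc n) (quotient (σ ∘ suc) (merge₀₁ ω))
      ∎
      where
      open ≡-Reasoning
      open Twins twins
      Q R S : Matrix (suc (suc n))
      Q = quotient σ ω
      R = updateAt Q zero (λ r j → r j ⊕ - + 1 * Q (suc zero) j)
      S i = updateAt (R i) (suc zero) (λ x → x ⊕ + 1 * R i zero)
      cancel : ∀ a t → a ⊕ t ⊕ - + 1 * (+ 0 ⊕ t) ≡ a
      cancel = solve-∀
      R₀₀ : R zero zero ≡ α
      R₀₀ = trans (cong₂ (λ a f → a ⊕ f * ω zero ⊕ - + 1 * (+ 0 ⊕ F (σ (suc zero)) (σ zero) * ω zero)) diagˡ (row (σ zero)))
                  (cancel α (F (σ (suc zero)) (σ zero) * ω zero))
      R₀₁ : R zero (suc zero) ≡ - α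
      R₀₁ = trans (cong₂ (λ f a → + 0 ⊕ f * ω (suc zero) ⊕ - + 1 * (a ⊕ F (σ (suc zero)) (σ (suc zero)) * ω (suc zero)))
                         (row (σ (suc zero))) diagʳ)
                  (negate α (F (σ (suc zero)) (σ (suc zero)) * ω (suc zero)))
        where negate : ∀ a t → + 0 ⊕ t ⊕ - + 1 * (a ⊕ t) ≡ - a
              negate = solve-∀
      S₀ : ∀ j → S zero (suc j) ≡ + 0
      S₀ zero    = trans (cong₂ (λ b a → b ⊕ + 1 * a) R₀₁ R₀₀) (annihilate α)
        where annihilate : ∀ a → - a ⊕ + 1 * a ≡ + 0
              annihilate = solve-∀
      S₀ (suc j) = trans
        (cong (λ f → + 0 ⊕ f * ω (suc (suc j)) ⊕ - + 1 * (+ 0 ⊕ F (σ (suc zero)) (σ (suc (suc j))) * ω (suc (suc j)))) (row (σ (suc (suc j)))))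
        (cancel (+ 0) (F (σ (suc zero)) (σ (suc (suc j))) * ω (suc (suc j))))
      minor-S : ∀ r c → minor S zero zero r c ≡ quotient (σ ∘ suc) (merge₀₁ ω) r c
      minor-S r zero = trans
        (cong (λ f → δ r zero (A (σ (suc r))) ⊕ F (σ (suc r)) (σ (suc zero)) * ω (suc zero) ⊕ + 1 * (+ 0 ⊕ f * ω zero)) (col (σ (suc r))))
        (collect (δ r zero (A (σ (suc r)))) (F (σ (suc r)) (σ (suc zero))) (ω (suc zero)) (ω zero))
        where collect : ∀ d f a b → d ⊕ f * a ⊕ + 1 * (+ 0 ⊕ f * b) ≡ d ⊕ f * (a ⊕ b)
              collect = solve-∀
      minor-S r (suc c) = refl

    -- Sends 0 to u and 1 to w.
    pairToFront : ∀ {n} (u w : Fin (suc (suc n))) → ¬ u ≡ w → Fin (suc (suc n)) → Fin (suc (suc n))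
    pairToFront u w u≢w = toFront w ∘ toFront (suc (punchOut (u≢w ∘ sym)))

    pairToFront-zero : ∀ {n} (u w : Fin (suc (suc n))) u≢w → pairToFront u w u≢w zero ≡ u
    pairToFront-zero u w u≢w = punchIn-punchOut (u≢w ∘ sym)

    det-quotient-pairToFront : ∀ n (σ : Fin (suc (suc n)) → V) ω u w u≢w → let π = pairToFront u w u≢w in
      det (suc (suc n)) (quotient (σ ∘ π) (ω ∘ π)) ≡ det (suc (suc n)) (quotient σ ω)
    det-quotient-pairToFront n σ ω u w u≢w = trans
      (det-quotient-toFront (suc n) (σ ∘ toFront w) (ω ∘ toFront w) (suc (punchOut (u≢w ∘ sym))))
      (det-quotient-toFront (suc n) σ ω w)

    ∑-pairToFront : ∀ n (f : Fin (suc (suc n)) → ℤ) u w u≢w →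
      ∑ (suc (suc n)) (f ∘ pairToFront u w u≢w) ≡ ∑ (suc (suc n)) f
    ∑-pairToFront n f u w u≢w = trans
      (∑-toFront (suc n) (f ∘ toFront w) (suc (punchOut (u≢w ∘ sym))))
      (∑-toFront (suc n) f w)

    module Reduction (α : ℤ) {Twin : V → V → Set} (twin? : ∀ x y → Dec (Twin x y))
                     (twins : ∀ {x y} → Twin x y → Twins α x y) where

      TwinInvariant : (V → ℤ) → Set
      TwinInvariant g = ∀ {x y} → Twin x y → g x ≡ g y

      TwinFree : ∀ {k} → (Fin k → V) → Set
      TwinFree σ = ∀ i j → ¬ i ≡ j → ¬ Twin (σ i) (σ j)

      record Reduced (k : ℕ) (σ : Fin k → V) (ω : Fin k → ℤ) : Set where
        field
          classes merges   : ℕ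
          k≡merges+classes : k ≡ merges + classes
          rep              : Fin classes → V
          weight           : Fin classes → ℤ
          rep-twinFree     : TwinFree rep
          rep-injective    : Injective _≡_ _≡_ σ → Injective _≡_ _≡_ rep
          det-quotient     : det k (quotient σ ω) ≡ α ^ merges * det classes (quotient rep weight)
          weightedSum      : ∀ g → TwinInvariant g →
                             ∑ classes (λ j → g (rep j) * weight j) ≡ ∑ k (λ j → g (σ j) * ω j)

      reduced-twinFree : ∀ {k} σ ω → TwinFree σ → Reduced k σ ω
      reduced-twinFree {k} σ ω twinFree = record
        { classes = k ; merges = 0 ; k≡merges+classes = refl
        ; rep = σ ; weight = ω ; rep-twinFree = twinFree ; rep-injective = λ σ-inj → σ-inj
        ; det-quotient = sym (ℤ.*-identityˡ _) ; weightedSum = λ _ _ → refl }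

      reduced-merge : ∀ n (σ : Fin (suc (suc n)) → V) ω u w (u≢w : ¬ u ≡ w) → Twin (σ u) (σ w) →
        let π = pairToFront u w u≢w in
        Reduced (suc n) (σ ∘ π ∘ suc) (merge₀₁ (ω ∘ π)) → Reduced (suc (suc n)) σ ω
      reduced-merge n σ ω u w u≢w twin R = record
        { classes = classes ; merges = suc merges ; k≡merges+classes = cong suc k≡merges+classes
        ; rep = rep ; weight = weight ; rep-twinFree = rep-twinFree
        ; rep-injective = λ σ-inj → rep-injective (suc-injective ∘ π-injective ∘ σ-inj)
        ; det-quotient = det-step
        ; weightedSum = λ g g-inv → trans (weightedSum g g-inv) (sum-step g g-inv) }
        where
        open Reduced R
        open ≡-Reasoning
        π : Fin (suc (suc n)) → Fin (suc (suc n))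
        π = pairToFront u w u≢w
        π-injective : Injective _≡_ _≡_ π
        π-injective = toFront-injective (suc (punchOut (u≢w ∘ sym))) ∘ toFront-injective w
        twin′ : Twin (σ (π zero)) (σ (π (suc zero)))
        twin′ = subst (λ x → Twin (σ x) (σ w)) (sym (pairToFront-zero u w u≢w)) twin
        det-step : det (suc (suc n)) (quotient σ ω) ≡ α ^ suc merges * det classes (quotient rep weight)
        det-step = begin
            det (suc (suc n)) (quotient σ ω)
          ≡⟨ det-quotient-pairToFront n σ ω u w u≢w ⟨
            det (suc (suc n)) (quotient (σ ∘ π) (ω ∘ π))
          ≡⟨ det-quotient-merge₀₁ n (σ ∘ π) (ω ∘ π) (twins twin′) ⟩
            α * det (suc n) (quotient (σ ∘ π ∘ suc) (merge₀₁ (ω ∘ π)))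
          ≡⟨ cong (α *_) det-quotient ⟩
            α * (α ^ merges * det classes (quotient rep weight))
          ≡⟨ ℤ.*-assoc α (α ^ merges) _ ⟨
            α ^ suc merges * det classes (quotient rep weight)
          ∎
        sum-step : ∀ g → TwinInvariant g →
          ∑ (suc n) (λ j → g (σ (π (suc j))) * merge₀₁ (ω ∘ π) j) ≡ ∑ (suc (suc n)) (λ j → g (σ j) * ω j)
        sum-step g g-inv = begin
            g (σ (π (suc zero))) * (ω (π (suc zero)) ⊕ ω (π zero)) ⊕ rest
          ≡⟨ cong (λ x → x * (ω (π (suc zero)) ⊕ ω (π zero)) ⊕ rest) (g-inv twin′) ⟨
            g (σ (π zero)) * (ω (π (suc zero)) ⊕ ω (π zero)) ⊕ rest
          ≡⟨ redistribute (g (σ (π zero))) (ω (π zero)) (ω (π (suc zero))) rest (g-inv twin′) ⟩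
            ∑ (suc (suc n)) (λ j → g (σ (π j)) * ω (π j))
          ≡⟨ ∑-pairToFront n (λ j → g (σ j) * ω j) u w u≢w ⟩
            ∑ (suc (suc n)) (λ j → g (σ j) * ω j)
          ∎
          where
          rest : ℤ
          rest = ∑ n (λ j → g (σ (π (suc (suc j)))) * ω (π (suc (suc j))))
          redistribute : ∀ x a b r → x ≡ g (σ (π (suc zero))) → x * (b ⊕ a) ⊕ r ≡ x * a ⊕ (g (σ (π (suc zero))) * b ⊕ r)
          redistribute x a b r refl = distrib x a b r
            where distrib : ∀ x a b r → x * (b ⊕ a) ⊕ r ≡ x * a ⊕ (x * b ⊕ r)
                  distrib = solve-∀

      TwinPair : ∀ {k} → (Fin k → V) → Set
      TwinPair σ = ∃[ u ] ∃[ w ] (¬ u ≡ w × Twin (σ u) (σ w))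

      twinPair? : ∀ {k} (σ : Fin k → V) → Dec (TwinPair σ)
      twinPair? σ = any? λ u → any? λ w → ¬? (u ≟ w) ×-dec twin? (σ u) (σ w)

      reduced-step : ∀ n (σ : Fin (suc (suc n)) → V) ω → Dec (TwinPair σ) →
        (∀ σ′ ω′ → Reduced (suc n) σ′ ω′) → Reduced (suc (suc n)) σ ω
      reduced-step n σ ω (yes (u , w , u≢w , twin)) reduce′ = reduced-merge n σ ω u w u≢w twin (reduce′ _ _)
      reduced-step n σ ω (no  noPair)               _       =
        reduced-twinFree σ ω (λ i j i≢j twin → noPair (i , j , i≢j , twin))

      reduce : ∀ k σ ω → Reduced k σ ω
      reduce zero          σ ω = reduced-twinFree σ ω (λ ())
      reduce (suc zero)    σ ω = reduced-twinFree σ ω λ { zero zero 0≢0 → contradiction refl 0≢0 }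
      reduce (suc (suc n)) σ ω = reduced-step n σ ω (twinPair? σ) (reduce (suc n))

module ModularArithmetic (p : ℕ) (p-prime : Prime p) where

  open import Data.Nat.Base
  open import Data.Nat.Properties
  open import Data.Nat.DivMod
  open import Data.Nat.Coprimality using (prime⇒coprime; coprime-Bézout)
  open import Data.Nat.GCD using (module Bézout)
  open import Data.Nat.Primality using (prime⇒nonTrivial)
  open import Data.Nat.Tactic.RingSolver using (solve-∀)
  open import Data.Product.Base using (∃-syntax; _,_)
  open import Relation.Binary.PropositionalEquality

  instance
    p≢0 : NonZero p
    p≢0 = prime⇒nonZero p-prime

  1<p : 1 < p
  1<p = nonTrivial⇒n>1 p {{prime⇒nonTrivial p-prime}}

  [m*[n%p]]%p≡[m*n]%p : ∀ m n → (m * (n % p)) % p ≡ (m * n) % p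
  [m*[n%p]]%p≡[m*n]%p m n = begin
    (m * (n % p)) % p            ≡⟨ %-distribˡ-* m (n % p) p ⟩
    (m % p * (n % p % p)) % p    ≡⟨ cong (λ x → (m % p * x) % p) (m%n%n≡m%n n p) ⟩
    (m % p * (n % p)) % p        ≡⟨ %-distribˡ-* m n p ⟨
    (m * n) % p                  ∎
    where open ≡-Reasoning

  [[m%p]*n]%p≡[m*n]%p : ∀ m n → (m % p * n) % p ≡ (m * n) % p
  [[m%p]*n]%p≡[m*n]%p m n = begin
    (m % p * n) % p    ≡⟨ cong (_% p) (*-comm (m % p) n) ⟩
    (n * (m % p)) % p  ≡⟨ [m*[n%p]]%p≡[m*n]%p n m ⟩
    (n * m) % p        ≡⟨ cong (_% p) (*-comm n m) ⟩
    (m * n) % p        ∎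
    where open ≡-Reasoning

  -- Bézout gives s t ≡ ±1 (mod p); in the case −1, the inverse is (p − 1) s.
  inverse : ∀ {t} → 0 < t → t < p → ∃[ s ] (s * t) % p ≡ 1
  inverse {t@(suc _)} _ t<p with coprime-Bézout (prime⇒coprime p-prime t<p)
  ... | Bézout.-+ x y eq = y , (begin
    (y * t) % p          ≡⟨ cong (_% p) eq ⟨
    (1 + x * p) % p      ≡⟨ [m+kn]%n≡m%n 1 x p ⟩
    1 % p                ≡⟨ m<n⇒m%n≡m 1<p ⟩
    1                    ∎)
    where open ≡-Reasoning
  ... | Bézout.+- x y eq = (p ∸ 1) * y , (begin
    ((p ∸ 1) * y * t) % p                  ≡⟨ [m+n]%n≡m%n ((p ∸ 1) * y * t) p ⟨
    ((p ∸ 1) * y * t + p) % p              ≡⟨ cong (_% p) (negate (p ∸ 1) y t x p (suc-pred p) eq) ⟩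
    (1 + (p ∸ 1) * x * p) % p              ≡⟨ [m+kn]%n≡m%n 1 ((p ∸ 1) * x) p ⟩
    1 % p                                  ≡⟨ m<n⇒m%n≡m 1<p ⟩
    1                                      ∎)
    where
    open ≡-Reasoning
    expand : ∀ q y t → q * y * t + suc q ≡ 1 + q * (1 + y * t)
    expand = solve-∀
    negate : ∀ q y t x p → suc q ≡ p → 1 + y * t ≡ x * p → q * y * t + p ≡ 1 + q * x * p
    negate q y t x .(suc q) refl eq = begin
      q * y * t + suc q     ≡⟨ expand q y t ⟩
      1 + q * (1 + y * t)   ≡⟨ cong (λ z → 1 + q * z) eq ⟩
      1 + q * (x * suc q)   ≡⟨ cong (1 +_) (*-assoc q x (suc q)) ⟨
      1 + q * x * suc q     ∎

  *-cancelʳ-≡-mod : ∀ {c} → 0 < c → c < p → ∀ a b → (a * c) % p ≡ (b * c) % p → a % p ≡ b % p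
  *-cancelʳ-≡-mod {c} 0<c c<p a b ac≡bc with inverse 0<c c<p
  ... | s , sc≡1 = trans (undo a) (trans (cong (λ x → (x * s) % p) ac≡bc) (sym (undo b)))
    where
    open ≡-Reasoning
    undo : ∀ a → a % p ≡ ((a * c) % p * s) % p
    undo a = begin
      a % p                      ≡⟨ cong (_% p) (*-identityʳ a) ⟨
      (a * 1) % p                ≡⟨ cong (λ x → (a * x) % p) sc≡1 ⟨
      (a * ((s * c) % p)) % p    ≡⟨ [m*[n%p]]%p≡[m*n]%p a (s * c) ⟩
      (a * (s * c)) % p          ≡⟨ cong (_% p) (rearrange a s c) ⟩
      (a * c * s) % p            ≡⟨ [[m%p]*n]%p≡[m*n]%p (a * c) s ⟨
      ((a * c) % p * s) % p      ∎
      where rearrange : ∀ a s c → a * (s * c) ≡ a * c * s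
            rearrange = solve-∀

module Zp³ (p : ℕ) (p-prime : Prime p) where

  open ModularArithmetic p p-prime
  open PowerGraph p using (N; elem; pow)
  open import Data.Nat.Base
  open import Data.Nat.Properties
  open import Data.Nat.DivMod
  open import Data.Fin.Base using (toℕ; fromℕ<)
  open import Data.Fin.Properties using (toℕ-injective; toℕ<n; toℕ-fromℕ<)
  open import Data.Product.Base using (_×_; _,_; proj₁; proj₂)
  open import Function.Base using (_∘_)
  open import Function.Definitions using (Injective)
  open import Relation.Binary.PropositionalEquality
  open import Relation.Nullary.Negation using (contradiction)

  0₃ : Triple
  0₃ = 0 , 0 , 0

  InRange : Triple → Set
  InRange (a , b , c) = a < p × b < p × c < p

  -- `elem k` unfolds to `digits (toℕ k)`.
  digits : ℕ → Triple
  digits n = n % p , (n / p) % p , (n / p / p) % p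

  undigits : Triple → ℕ
  undigits (a , b , c) = a + (b + c * p) * p

  undigits-digits : ∀ {n} → n < N → undigits (digits n) ≡ n
  undigits-digits {n} n<N = begin
      n % p + ((n / p) % p + ((n / p / p) % p) * p) * p
    ≡⟨ cong (λ c → n % p + ((n / p) % p + c * p) * p) (m<n⇒m%n≡m n/p/p<p) ⟩
      n % p + ((n / p) % p + (n / p / p) * p) * p
    ≡⟨ cong (λ b → n % p + b * p) (m≡m%n+[m/n]*n (n / p) p) ⟨
      n % p + (n / p) * p
    ≡⟨ m≡m%n+[m/n]*n n p ⟨
      n
    ∎
    where
    open ≡-Reasoning
    n/p/p<p : n / p / p < p
    n/p/p<p = m<n*o⇒m/o<n (m<n*o⇒m/o<n {n} {p * p} {p} n<N)

  a+q*p-divMod : ∀ {a} q → a < p → (a + q * p) % p ≡ a × (a + q * p) / p ≡ q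
  a+q*p-divMod {a} q a<p = trans ([m+kn]%n≡m%n a q p) (m<n⇒m%n≡m a<p) , (begin
      (a + q * p) / p
    ≡⟨ +-distrib-/ a (q * p) (subst (_< p) (sym (trans (cong₂ _+_ (m<n⇒m%n≡m a<p) (m*n%n≡0 q p)) (+-identityʳ a))) a<p) ⟩
      a / p + q * p / p
    ≡⟨ cong₂ _+_ (m<n⇒m/n≡0 a<p) (m*n/n≡m q p) ⟩
      q
    ∎)
    where open ≡-Reasoning

  digits-undigits : ∀ {t} → InRange t → digits (undigits t) ≡ t
  digits-undigits {a , b , c} (a<p , b<p , c<p) =
    cong₂ _,_ (proj₁ digit₀) (cong₂ _,_
      (trans (cong (_% p) (proj₂ digit₀)) (proj₁ digit₁))
      (trans (cong (λ m → m / p % p) (proj₂ digit₀)) (trans (cong (_% p) (proj₂ digit₁)) (m<n⇒m%n≡m c<p))))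
    where
    digit₀ : (a + (b + c * p) * p) % p ≡ a × (a + (b + c * p) * p) / p ≡ b + c * p
    digit₀ = a+q*p-divMod (b + c * p) a<p
    digit₁ : (b + c * p) % p ≡ b × (b + c * p) / p ≡ c
    digit₁ = a+q*p-divMod c b<p

  undigits-< : ∀ {t} → InRange t → undigits t < N
  undigits-< {a , b , c} (a<p , b<p , c<p) = bound a<p (bound b<p c<p)
    where
    bound : ∀ {a q r} → a < p → q < r → a + q * p < r * p
    bound {a} {q} {r} a<p q<r = <-≤-trans (+-monoˡ-< (q * p) a<p) (*-monoˡ-≤ p q<r)

  elem-injective : Injective _≡_ _≡_ elem
  elem-injective {u} {v} eq = toℕ-injective (begin
    toℕ u                    ≡⟨ undigits-digits (toℕ<n u) ⟨
    undigits (elem u)        ≡⟨ cong undigits eq ⟩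
    undigits (elem v)        ≡⟨ undigits-digits (toℕ<n v) ⟩
    toℕ v                    ∎)
    where open ≡-Reasoning

  vertex : ∀ t → InRange t → Fin N
  vertex t t∈ = fromℕ< (undigits-< t∈)

  elem-vertex : ∀ t (t∈ : InRange t) → elem (vertex t t∈) ≡ t
  elem-vertex t t∈ = trans (cong digits (toℕ-fromℕ< (undigits-< t∈))) (digits-undigits t∈)

  0₃-inRange : InRange 0₃
  0₃-inRange = 0<p , 0<p , 0<p
    where
    0<p : 0 < p
    0<p = >-nonZero⁻¹ p

  elem-inRange : ∀ v → InRange (elem v)
  elem-inRange v = m%n<n _ p , m%n<n _ p , m%n<n _ p

  pow-inRange : ∀ t i → InRange (pow t i)
  pow-inRange (a , b , c) i = m%n<n _ p , m%n<n _ p , m%n<n _ p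

  pow-% : ∀ t i → pow t (i % p) ≡ pow t i
  pow-% (a , b , c) i = cong₂ _,_ ([[m%p]*n]%p≡[m*n]%p i a) (cong₂ _,_ ([[m%p]*n]%p≡[m*n]%p i b) ([[m%p]*n]%p≡[m*n]%p i c))

  pow-zero : ∀ t → pow t 0 ≡ 0₃
  pow-zero (a , b , c) = cong₂ _,_ 0%p≡0 (cong₂ _,_ 0%p≡0 0%p≡0)
    where
    0%p≡0 : 0 % p ≡ 0
    0%p≡0 = m<n⇒m%n≡m (>-nonZero⁻¹ p)

  pow-one : ∀ {t} → InRange t → pow t 1 ≡ t
  pow-one {a , b , c} (a<p , b<p , c<p) = cong₂ _,_ (one a<p) (cong₂ _,_ (one b<p) (one c<p))
    where
    one : ∀ {a} → a < p → (1 * a) % p ≡ a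
    one {a} a<p = trans (cong (_% p) (*-identityˡ a)) (m<n⇒m%n≡m a<p)

  pow-pow : ∀ t i j → pow (pow t i) j ≡ pow t (j * i)
  pow-pow (a , b , c) i j = cong₂ _,_ (assoc a) (cong₂ _,_ (assoc b) (assoc c))
    where
    assoc : ∀ a → (j * ((i * a) % p)) % p ≡ ((j * i) * a) % p
    assoc a = trans ([m*[n%p]]%p≡[m*n]%p j (i * a)) (cong (_% p) (sym (*-assoc j i a)))

  pow-cancel : ∀ {t} → InRange t → t ≢ 0₃ → ∀ i j → pow t i ≡ pow t j → i % p ≡ j % p
  pow-cancel {suc a , b , c}     (a<p , _)         _   i j eq = *-cancelʳ-≡-mod z<s a<p i j (cong proj₁ eq)
  pow-cancel {0 , suc b , c}     (_ , b<p , _)     _   i j eq = *-cancelʳ-≡-mod z<s b<p i j (cong (proj₁ ∘ proj₂) eq)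
  pow-cancel {0 , 0 , suc c}     (_ , _ , c<p)     _   i j eq = *-cancelʳ-≡-mod z<s c<p i j (cong (proj₂ ∘ proj₂) eq)
  pow-cancel {0 , 0 , 0}         _                 t≢0 _ _ _  = contradiction refl t≢0

module CyclicSubgroups (p : ℕ) (p-prime : Prime p) where

  open ModularArithmetic p p-prime
  open Zp³ p p-prime
  open PowerGraph p using (N; elem; pow)
  open FinSum using (𝟙; ∑-𝟙-image)
  open import Data.Nat.Base
  open import Data.Nat.Properties using (+-suc; suc-pred) renaming (_≟_ to _≟ℕ_)
  open import Data.Integer.Base using (+_)
  open import Data.Nat.DivMod using (_%_; m%n<n; [m+n]%n≡m%n; m<n⇒m%n≡m)
  open import Data.Fin.Base using (toℕ; fromℕ<)
  open import Data.Fin.Properties using (_≟_; any?; toℕ-fromℕ<; toℕ<n; toℕ-injective)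
  open import Data.Product.Base using (∃-syntax; _×_; _,_)
  import Data.Product.Properties as ×
  open import Function.Base using (_∘_)
  open import Function.Definitions using (Injective)
  open import Relation.Binary.PropositionalEquality
  open import Relation.Nullary.Decidable using (Dec)
  open import Relation.Nullary.Negation using (¬_; contradiction)

  _≟₃_ : ∀ (s t : Triple) → Dec (s ≡ t)
  _≟₃_ = ×.≡-dec _≟ℕ_ (×.≡-dec _≟ℕ_ _≟ℕ_)

  e : Fin N
  e = vertex 0₃ 0₃-inRange

  elem-e : elem e ≡ 0₃
  elem-e = elem-vertex 0₃ 0₃-inRange

  elem≡0₃⇒≡e : ∀ {v} → elem v ≡ 0₃ → v ≡ e
  elem≡0₃⇒≡e eq = elem-injective (trans eq (sym elem-e))

  infix 4 _∈⟨_⟩ _∈?⟨_⟩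

  _∈⟨_⟩ : Fin N → Fin N → Set
  v ∈⟨ u ⟩ = ∃[ t ] elem v ≡ pow (elem u) (toℕ {p} t)

  _∈?⟨_⟩ : ∀ v u → Dec (v ∈⟨ u ⟩)
  v ∈?⟨ u ⟩ = any? λ t → elem v ≟₃ pow (elem u) (toℕ t)

  ∈⟨⟩-intro : ∀ {u v} i → elem v ≡ pow (elem u) i → v ∈⟨ u ⟩
  ∈⟨⟩-intro {u} i eq = fromℕ< (m%n<n i p) , trans eq (trans (sym (pow-% (elem u) i))
                                                         (cong (pow (elem u)) (sym (toℕ-fromℕ< (m%n<n i p)))))

  ∈⟨⟩-refl : ∀ u → u ∈⟨ u ⟩
  ∈⟨⟩-refl u = ∈⟨⟩-intro 1 (sym (pow-one (elem-inRange u)))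

  ∈⟨⟩-trans : ∀ {u v w} → w ∈⟨ v ⟩ → v ∈⟨ u ⟩ → w ∈⟨ u ⟩
  ∈⟨⟩-trans {u} {v} {w} (s , w≡sv) (t , v≡tu) = ∈⟨⟩-intro (toℕ s * toℕ t)
    (trans w≡sv (trans (cong (λ x → pow x (toℕ s)) v≡tu) (pow-pow (elem u) (toℕ t) (toℕ s))))

  e∈⟨⟩ : ∀ u → e ∈⟨ u ⟩
  e∈⟨⟩ u = ∈⟨⟩-intro 0 (trans elem-e (sym (pow-zero (elem u))))

  exponent-pos : ∀ {u v} i → ¬ v ≡ e → elem v ≡ pow (elem u) i → 0 < i
  exponent-pos {u} zero    v≢e v≡0u = contradiction (elem≡0₃⇒≡e (trans v≡0u (pow-zero (elem u)))) v≢e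
  exponent-pos     (suc i) _   _     = z<s

  ∈⟨⟩-sym : ∀ {u v} → ¬ v ≡ e → v ∈⟨ u ⟩ → u ∈⟨ v ⟩
  ∈⟨⟩-sym {u} {v} v≢e (t , v≡tu) with inverse (exponent-pos (toℕ t) v≢e v≡tu) (toℕ<n t)
  ... | s , st≡1 = ∈⟨⟩-intro s (sym (begin
      pow (elem v) s                  ≡⟨ cong (λ x → pow x s) v≡tu ⟩
      pow (pow (elem u) (toℕ t)) s    ≡⟨ pow-pow (elem u) (toℕ t) s ⟩
      pow (elem u) (s * toℕ t)        ≡⟨ pow-% (elem u) (s * toℕ t) ⟨
      pow (elem u) ((s * toℕ t) % p)  ≡⟨ cong (pow (elem u)) st≡1 ⟩
      pow (elem u) 1                  ≡⟨ pow-one (elem-inRange u) ⟩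
      elem u                          ∎))
    where open ≡-Reasoning

  ∈⟨⟩⇒positivePower : ∀ {u v} → v ∈⟨ u ⟩ → ∃[ i ] elem v ≡ pow (elem u) (suc i)
  ∈⟨⟩⇒positivePower {u} {v} (t , v≡tu) = toℕ t + (p ∸ 1) , (begin
    elem v                                  ≡⟨ v≡tu ⟩
    pow (elem u) (toℕ t)                    ≡⟨ pow-% (elem u) (toℕ t) ⟨
    pow (elem u) (toℕ t % p)                ≡⟨ cong (pow (elem u)) ([m+n]%n≡m%n (toℕ t) p) ⟨
    pow (elem u) ((toℕ t + p) % p)          ≡⟨ pow-% (elem u) (toℕ t + p) ⟩
    pow (elem u) (toℕ t + p)                ≡⟨ cong (λ i → pow (elem u) (toℕ t + i)) (suc-pred p) ⟨
    pow (elem u) (toℕ t + suc (p ∸ 1))      ≡⟨ cong (pow (elem u)) (+-suc (toℕ t) (p ∸ 1)) ⟩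
    pow (elem u) (suc (toℕ t + (p ∸ 1)))    ∎)
    where open ≡-Reasoning

  power : Fin N → Fin p → Fin N
  power u t = vertex (pow (elem u) (toℕ t)) (pow-inRange (elem u) (toℕ t))

  power-injective : ∀ {u} → ¬ u ≡ e → Injective _≡_ _≡_ (power u)
  power-injective {u} u≢e {s} {t} eq = toℕ-injective (begin
    toℕ s       ≡⟨ m<n⇒m%n≡m (toℕ<n s) ⟨
    toℕ s % p   ≡⟨ pow-cancel (elem-inRange u) (u≢e ∘ elem≡0₃⇒≡e) (toℕ s) (toℕ t) powers ⟩
    toℕ t % p   ≡⟨ m<n⇒m%n≡m (toℕ<n t) ⟩
    toℕ t       ∎)
    where
    open ≡-Reasoning
    powers : pow (elem u) (toℕ s) ≡ pow (elem u) (toℕ t)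
    powers = trans (sym (elem-vertex _ (pow-inRange (elem u) (toℕ s))))
                   (trans (cong elem eq) (elem-vertex _ (pow-inRange (elem u) (toℕ t))))

  ∣⟨⟩∣≡p : ∀ {u} → ¬ u ≡ e → ∑ N (λ v → 𝟙 (v ∈?⟨ u ⟩)) ≡ + p
  ∣⟨⟩∣≡p {u} u≢e = ∑-𝟙-image (power u) (power-injective u≢e) (_∈?⟨ u ⟩)
    (λ { (t , v≡tu) → t , elem-injective (trans v≡tu (sym (elem-vertex _ (pow-inRange (elem u) (toℕ t))))) })
    (λ t → t , elem-vertex _ (pow-inRange (elem u) (toℕ t)))

module Distances (p : ℕ) (p-prime : Prime p) where

  open ModularArithmetic p p-prime using (p≢0)
  open CyclicSubgroups p p-prime
  open PowerGraph p using (N; Adj; Walk; here; there; IsDistance; Tr)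
  open FinSum
  open import Data.Nat.Base using (suc; _≤_; s≤s)
  open import Data.Nat.Properties using (n≤0⇒n≡0)
  open import Data.Integer.Base using (+_; _+_; _-_; _*_)
  import Data.Integer.Properties as ℤ
  open import Data.Fin.Properties using (_≟_)
  open import Data.Bool.Base using (true; false; if_then_else_)
  open import Data.Product.Base using (_,_; proj₁; proj₂)
  open import Data.Sum.Base using (_⊎_; inj₁; inj₂; swap)
  open import Function.Base using (_∘_)
  open import Function.Bundles using (mk⇔)
  open import Relation.Binary.PropositionalEquality
  open import Relation.Nullary.Decidable using (Dec; yes; no; does; _⊎-dec_; does-⇔; dec-true; dec-false)
  open import Relation.Nullary.Negation using (¬_; contradiction)

  Comparable : Fin N → Fin N → Set
  Comparable u v = u ∈⟨ v ⟩ ⊎ v ∈⟨ u ⟩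

  comparable? : ∀ u v → Dec (Comparable u v)
  comparable? u v = u ∈?⟨ v ⟩ ⊎-dec v ∈?⟨ u ⟩

  closedDist : Fin N → Fin N → ℕ
  closedDist u v = if does (comparable? u v) then 1 else 2

  distance : Fin N → Fin N → ℕ
  distance u v = if does (u ≟ v) then 0 else closedDist u v

  comparable-transfer : ∀ {u v z} → u ∈⟨ v ⟩ → v ∈⟨ u ⟩ → Comparable u z → Comparable v z
  comparable-transfer u∈⟨v⟩ v∈⟨u⟩ (inj₁ u∈⟨z⟩) = inj₁ (∈⟨⟩-trans v∈⟨u⟩ u∈⟨z⟩)
  comparable-transfer u∈⟨v⟩ v∈⟨u⟩ (inj₂ z∈⟨u⟩) = inj₂ (∈⟨⟩-trans z∈⟨u⟩ u∈⟨v⟩)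

  closedDist-congˡ : ∀ {u v} → u ∈⟨ v ⟩ → v ∈⟨ u ⟩ → ∀ z → closedDist u z ≡ closedDist v z
  closedDist-congˡ {u} {v} u∈⟨v⟩ v∈⟨u⟩ z = cong (λ b → if b then 1 else 2)
    (does-⇔ (mk⇔ (comparable-transfer u∈⟨v⟩ v∈⟨u⟩) (comparable-transfer v∈⟨u⟩ u∈⟨v⟩)) (comparable? u z) (comparable? v z))

  closedDist-congʳ : ∀ {u v} → u ∈⟨ v ⟩ → v ∈⟨ u ⟩ → ∀ z → closedDist z u ≡ closedDist z v
  closedDist-congʳ {u} {v} u∈⟨v⟩ v∈⟨u⟩ z = cong (λ b → if b then 1 else 2)
    (does-⇔ (mk⇔ (swap ∘ comparable-transfer u∈⟨v⟩ v∈⟨u⟩ ∘ swap) (swap ∘ comparable-transfer v∈⟨u⟩ u∈⟨v⟩ ∘ swap))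
            (comparable? z u) (comparable? z v))

  closedDist-comparable : ∀ {u v} → Comparable u v → closedDist u v ≡ 1
  closedDist-comparable {u} {v} comp = cong (λ b → if b then 1 else 2) (dec-true (comparable? u v) comp)

  closedDist-incomparable : ∀ {u v} → ¬ Comparable u v → closedDist u v ≡ 2
  closedDist-incomparable {u} {v} ¬comp = cong (λ b → if b then 1 else 2) (dec-false (comparable? u v) ¬comp)

  comparable⇒adjacent : ∀ {u v} → ¬ u ≡ v → Comparable u v → Adj u v
  comparable⇒adjacent u≢v (inj₁ u∈⟨v⟩) = u≢v , inj₂ (∈⟨⟩⇒positivePower u∈⟨v⟩)
  comparable⇒adjacent u≢v (inj₂ v∈⟨u⟩) = u≢v , inj₁ (∈⟨⟩⇒positivePower v∈⟨u⟩)

  adjacent⇒comparable : ∀ {u v} → Adj u v → Comparable u v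
  adjacent⇒comparable (_ , inj₁ (i , v≡u^i)) = inj₂ (∈⟨⟩-intro (suc i) v≡u^i)
  adjacent⇒comparable (_ , inj₂ (j , u≡v^j)) = inj₁ (∈⟨⟩-intro (suc j) u≡v^j)

  e-comparable : ∀ v → Comparable e v
  e-comparable v = inj₁ (e∈⟨⟩ v)

  module _ {d : Fin N → Fin N → ℕ} (d-isDistance : IsDistance d) where

    private
      shortest : ∀ {u v} k → Walk u v k → d u v ≤ k
      shortest {u} {v} = proj₂ (d-isDistance u v)

    d-refl : ∀ u → d u u ≡ 0
    d-refl u = n≤0⇒n≡0 (shortest 0 here)

    d-adjacent : ∀ {u v} → Adj u v → d u v ≡ 1
    d-adjacent {u} {v} adj with d u v | proj₁ (d-isDistance u v) | shortest 1 (there adj here)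
    ... | 0           | here | _ = contradiction refl (proj₁ adj)
    ... | 1           | _    | _ = refl
    ... | suc (suc _) | _    | s≤s ()

    d-nonadjacent : ∀ {u v} → ¬ u ≡ v → ¬ Adj u v → Walk u v 2 → d u v ≡ 2
    d-nonadjacent {u} {v} u≢v ¬adj walk with d u v | proj₁ (d-isDistance u v) | shortest 2 walk
    ... | 0                 | here               | _ = contradiction refl u≢v
    ... | 1                 | there adj here     | _ = contradiction adj ¬adj
    ... | 2                 | _                  | _ = refl
    ... | suc (suc (suc _)) | _                  | s≤s (s≤s ())

    d≡closedDist : ∀ {u v} → ¬ u ≡ v → d u v ≡ closedDist u v
    d≡closedDist {u} {v} u≢v with comparable? u v
    ... | yes comp = trans (d-adjacent (comparable⇒adjacent u≢v comp)) (sym (closedDist-comparable comp))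
    ... | no ¬comp = trans (d-nonadjacent u≢v (¬comp ∘ adjacent⇒comparable) (there u~e (there e~v here)))
                           (sym (closedDist-incomparable ¬comp))
      where
      u~e : Adj u e
      u~e = comparable⇒adjacent (λ { refl → ¬comp (e-comparable v) }) (inj₂ (e∈⟨⟩ u))
      e~v : Adj e v
      e~v = comparable⇒adjacent (λ { refl → ¬comp (inj₂ (e∈⟨⟩ u)) }) (e-comparable v)

    d≡distance : ∀ u v → d u v ≡ distance u v
    d≡distance u v with u ≟ v
    ... | yes refl = d-refl u
    ... | no  u≢v  = d≡closedDist u≢v

  closedDist-refl : ∀ u → closedDist u u ≡ 1
  closedDist-refl u = closedDist-comparable (inj₁ (∈⟨⟩-refl u))

  distance≡closedDist-δ : ∀ u v → + distance u v ≡ + closedDist u v - δ u v (+ 1)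
  distance≡closedDist-δ u v with u ≟ v
  ... | yes refl rewrite closedDist-refl u = refl
  ... | no  _    = sym (ℤ.+-identityʳ (+ closedDist u v))

  ∑-closedDist-e : ∑ N (λ v → + closedDist e v) ≡ + N
  ∑-closedDist-e = begin
    ∑ N (λ v → + closedDist e v)  ≡⟨ ∑-cong N (λ v → cong +_ (closedDist-comparable (e-comparable v))) ⟩
    ∑ N (λ _ → + 1)               ≡⟨ ∑-const N (+ 1) ⟩
    + N * + 1                     ≡⟨ ℤ.*-identityʳ (+ N) ⟩
    + N                           ∎
    where open ≡-Reasoning

  ∑-closedDist-≢e : ∀ {u} → ¬ u ≡ e → ∑ N (λ v → + closedDist u v) ≡ + 2 * + N - + p
  ∑-closedDist-≢e {u} u≢e = begin
    ∑ N (λ v → + closedDist u v)                    ≡⟨ ∑-cong N closedDist≡2-𝟙 ⟩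
    ∑ N (λ v → + 2 - 𝟙 (v ∈?⟨ u ⟩))                 ≡⟨ ∑-distrib-minus N (λ _ → + 2) (λ v → 𝟙 (v ∈?⟨ u ⟩)) ⟩
    ∑ N (λ _ → + 2) - ∑ N (λ v → 𝟙 (v ∈?⟨ u ⟩))     ≡⟨ cong₂ _-_ (∑-const N (+ 2)) (∣⟨⟩∣≡p u≢e) ⟩
    + N * + 2 - + p                                 ≡⟨ cong (_- + p) (ℤ.*-comm (+ N) (+ 2)) ⟩
    + 2 * + N - + p                                 ∎
    where
    open ≡-Reasoning
    comparable⇔∈⟨⟩ : ∀ v → does (comparable? u v) ≡ does (v ∈?⟨ u ⟩)
    comparable⇔∈⟨⟩ v = does-⇔ (mk⇔ (λ { (inj₁ u∈⟨v⟩) → ∈⟨⟩-sym u≢e u∈⟨v⟩ ; (inj₂ v∈⟨u⟩) → v∈⟨u⟩ }) inj₂)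
                              (comparable? u v) (v ∈?⟨ u ⟩)
    bool : ∀ b → + (if b then 1 else 2) ≡ + 2 - (if b then + 1 else + 0)
    bool true  = refl
    bool false = refl
    closedDist≡2-𝟙 : ∀ v → + closedDist u v ≡ + 2 - 𝟙 (v ∈?⟨ u ⟩)
    closedDist≡2-𝟙 v = trans (cong (λ b → + (if b then 1 else 2)) (comparable⇔∈⟨⟩ v)) (bool (does (v ∈?⟨ u ⟩)))

  Tr≡∑closedDist : ∀ {d} → IsDistance d → ∀ u → Tr d u ≡ ∑ N (λ v → + closedDist u v) - + 1
  Tr≡∑closedDist {d} d-isDistance u = begin
    ∑ N (λ v → + d u v)                                     ≡⟨ ∑-cong N (λ v → cong +_ (d≡distance d-isDistance u v)) ⟩
    ∑ N (λ v → + distance u v)                              ≡⟨ ∑-cong N (distance≡closedDist-δ u) ⟩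
    ∑ N (λ v → + closedDist u v - δ u v (+ 1))              ≡⟨ ∑-distrib-minus N (λ v → + closedDist u v) (λ v → δ u v (+ 1)) ⟩
    ∑ N (λ v → + closedDist u v) - ∑ N (λ v → δ u v (+ 1))  ≡⟨ cong (∑ N (λ v → + closedDist u v) -_) (∑-δˡ N u (+ 1)) ⟩
    ∑ N (λ v → + closedDist u v) - + 1                      ∎
    where open ≡-Reasoning

module Spectrum (p : ℕ) (p-prime : Prime p) (x : ℤ) where

  open ModularArithmetic p p-prime using (p≢0; 1<p)
  open CyclicSubgroups p p-prime
  open Distances p p-prime
  open PowerGraph p using (N; IsDistance; Tr; charMat)
  open FinSum
  open Determinant using (det-cong; det₂)
  open QuotientMatrix
  import Data.Nat.Base as ℕ
  import Data.Nat.Properties as ℕ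
  open import Data.Nat.Base using (zero; suc)
  open import Data.Integer.Base using (+_; _+_; _-_; _*_; _^_)
  import Data.Integer.Properties as ℤ
  open import Data.Integer.Tactic.RingSolver using (solve-∀)
  import Data.Nat.Tactic.RingSolver as ℕSolver
  open import Data.Fin.Base using (zero; suc; punchIn)
  open import Data.Fin.Properties using (_≟_; any?; punchInᵢ≢i)
  open import Data.Bool.Base using (if_then_else_)
  open import Data.Product.Base using (∃-syntax; _×_; _,_; proj₁; proj₂)
  open import Data.Sum.Base using (_⊎_; inj₁; inj₂)
  open import Function.Base using (_∘_; id)
  open import Function.Bundles using (_⇔_; mk⇔)
  open import Function.Definitions using (Injective)
  open import Relation.Binary.PropositionalEquality
  open import Relation.Nullary.Decidable using (Dec; yes; no; does; ¬?; _×-dec_; _⊎-dec_; does-⇔; dec-true; dec-false)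
  open import Relation.Nullary.Negation using (¬_; contradiction)

  V : Set
  V = Fin N

  α₁ α₂ : ℤ
  α₁ = x - + 2 * + N + + p
  α₂ = x - + 2 * + N + + 1

  A₁ A₂ : V → ℤ
  A₁ v = if does (v ≟ e) then x - + N else α₁
  A₂ v = if does (v ≟ e) then x - + N else α₂

  F₁ F₂ : V → V → ℤ
  F₁ u v = + closedDist u v
  F₂ u v = if does (u ≟ e) then + 1 else if does (v ≟ e) then + 1 else + 2

  Twin₁ Twin₂ : V → V → Set
  Twin₁ u v = ¬ u ≡ e × ¬ v ≡ e × v ∈⟨ u ⟩
  Twin₂ u v = ¬ u ≡ e × ¬ v ≡ e

  twin₁? : ∀ u v → Dec (Twin₁ u v)
  twin₁? u v = ¬? (u ≟ e) ×-dec ¬? (v ≟ e) ×-dec v ∈?⟨ u ⟩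

  twin₂? : ∀ u v → Dec (Twin₂ u v)
  twin₂? u v = ¬? (u ≟ e) ×-dec ¬? (v ≟ e)

  by-e : ∀ {P : V → Set} → P e → (∀ {v} → ¬ v ≡ e → P v) → ∀ v → P v
  by-e Pe P≢e v with v ≟ e
  ... | yes refl = Pe
  ... | no  v≢e  = P≢e v≢e

  if-e : ∀ {A : Set} {a b : A} → (if does (e ≟ e) then a else b) ≡ a
  if-e {a = a} {b} = cong (λ c → if c then a else b) (dec-true (e ≟ e) refl)

  if-≢e : ∀ {A : Set} {a b : A} {v} → ¬ v ≡ e → (if does (v ≟ e) then a else b) ≡ b
  if-≢e {a = a} {b} {v} v≢e = cong (λ c → if c then a else b) (dec-false (v ≟ e) v≢e)

  twins₁ : ∀ {u v} → Twin₁ u v → Twins A₁ F₁ α₁ u v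
  twins₁ {u} {v} (u≢e , v≢e , v∈⟨u⟩) = record
    { diagˡ = if-≢e u≢e
    ; diagʳ = if-≢e v≢e
    ; row   = cong +_ ∘ closedDist-congˡ u∈⟨v⟩ v∈⟨u⟩
    ; col   = cong +_ ∘ closedDist-congʳ u∈⟨v⟩ v∈⟨u⟩ }
    where
    u∈⟨v⟩ : u ∈⟨ v ⟩
    u∈⟨v⟩ = ∈⟨⟩-sym v≢e v∈⟨u⟩

  twins₂ : ∀ {u v} → Twin₂ u v → Twins A₂ F₂ α₂ u v
  twins₂ {u} {v} (u≢e , v≢e) = record
    { diagˡ = if-≢e u≢e
    ; diagʳ = if-≢e v≢e
    ; row   = λ z → trans (if-≢e u≢e) (sym (if-≢e v≢e))
    ; col   = λ z → cong (λ c → if does (z ≟ e) then + 1 else c) (trans (if-≢e u≢e) (sym (if-≢e v≢e))) }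

  module _ {d} (d-isDistance : IsDistance d) where

    A₁≡x-Tr-1 : ∀ u → A₁ u ≡ x - Tr d u - + 1
    A₁≡x-Tr-1 u with u ≟ e
    ... | yes refl = begin
      x - + N                                         ≡⟨ shift x (+ N) ⟩
      x - (+ N - + 1) - + 1                           ≡⟨ cong (λ t → x - (t - + 1) - + 1) ∑-closedDist-e ⟨
      x - (∑ N (λ v → + closedDist e v) - + 1) - + 1  ≡⟨ cong (λ t → x - t - + 1) (Tr≡∑closedDist d-isDistance e) ⟨
      x - Tr d e - + 1                                ∎
      where
      open ≡-Reasoning
      shift : ∀ x n → x - n ≡ x - (n - + 1) - + 1
      shift = solve-∀
    ... | no u≢e = begin
      x - + 2 * + N + + p                             ≡⟨ shift x (+ N) (+ p) ⟩
      x - (+ 2 * + N - + p - + 1) - + 1               ≡⟨ cong (λ t → x - (t - + 1) - + 1) (∑-closedDist-≢e u≢e) ⟨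
      x - (∑ N (λ v → + closedDist u v) - + 1) - + 1  ≡⟨ cong (λ t → x - t - + 1) (Tr≡∑closedDist d-isDistance u) ⟨
      x - Tr d u - + 1                                ∎
      where
      open ≡-Reasoning
      shift : ∀ x n p → x - + 2 * n + p ≡ x - (+ 2 * n - p - + 1) - + 1
      shift = solve-∀

    charMat≗quotient₁ : ∀ u v → charMat d x u v ≡ quotient A₁ F₁ id (λ _ → + 1) u v
    charMat≗quotient₁ u v with u ≟ v
    ... | yes refl = begin
      x - (Tr d u - + d u u)             ≡⟨ cong (λ k → x - (Tr d u - + k)) (d-refl d-isDistance u) ⟩
      x - (Tr d u - + 0)                 ≡⟨ diagonal x (Tr d u) ⟩
      (x - Tr d u - + 1) + + 1 * + 1     ≡⟨ cong₂ (λ a k → a + + k * + 1) (A₁≡x-Tr-1 u) (closedDist-refl u) ⟨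
      A₁ u + F₁ u u * + 1                ∎
      where
      open ≡-Reasoning
      diagonal : ∀ x t → x - (t - + 0) ≡ (x - t - + 1) + + 1 * + 1
      diagonal = solve-∀
    ... | no u≢v = begin
      + 0 - (+ 0 - + d u v)              ≡⟨ offDiagonal (+ d u v) ⟩
      + 0 + + d u v * + 1                ≡⟨ cong (λ k → + 0 + + k * + 1) (d≡closedDist d-isDistance u≢v) ⟩
      + 0 + F₁ u v * + 1                 ∎
      where
      open ≡-Reasoning
      offDiagonal : ∀ t → + 0 - (+ 0 - t) ≡ + 0 + t * + 1
      offDiagonal = solve-∀

  module Stage₁ = Reduction A₁ F₁ α₁ twin₁? twins₁
  module Stage₂ = Reduction A₂ F₂ α₂ twin₂? twins₂

  q : ℕ
  q = p ℕ.∸ 1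

  instance
    q≢0 : ℕ.NonZero q
    q≢0 = ℕ.>-nonZero (ℕ.m<n⇒0<n∸m 1<p)

  q+1≡p : + q + + 1 ≡ + p
  q+1≡p = cong +_ (ℕ.m∸n+n≡m (ℕ.<⇒≤ 1<p))

  classSize : V → ℤ
  classSize v = if does (v ≟ e) then + 1 else + q

  e-index : ∀ {k} (σ : Fin k → V) (ω : Fin k → ℤ) → ∑ k (λ j → 𝟙 (σ j ≟ e) * ω j) ≡ + 1 → ∃[ i ] σ i ≡ e
  e-index {k} σ ω sum≡1 with any? (λ i → σ i ≟ e)
  ... | yes found = found
  ... | no  none  = contradiction (trans (sym sum≡1) (∑-zero k {λ j → 𝟙 (σ j ≟ e) * ω j} vanish)) λ ()
    where
    vanish : ∀ j → 𝟙 (σ j ≟ e) * ω j ≡ + 0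
    vanish j = trans (cong (_* ω j) (𝟙-no (σ j ≟ e) (none ∘ (j ,_)))) (ℤ.*-zeroˡ (ω j))

  𝟙e-invariant₁ : Stage₁.TwinInvariant (λ v → 𝟙 (v ≟ e))
  𝟙e-invariant₁ {a} {b} (a≢e , b≢e , _) = trans (𝟙-no (a ≟ e) a≢e) (sym (𝟙-no (b ≟ e) b≢e))

  𝟙e-invariant₂ : Stage₂.TwinInvariant (λ v → 𝟙 (v ≟ e))
  𝟙e-invariant₂ {a} {b} (a≢e , b≢e) = trans (𝟙-no (a ≟ e) a≢e) (sym (𝟙-no (b ≟ e) b≢e))

  ∑-𝟙e : ∑ N (λ v → 𝟙 (v ≟ e) * + 1) ≡ + 1
  ∑-𝟙e = trans (∑-cong N (λ v → ℤ.*-identityʳ (𝟙 (v ≟ e)))) (∑-δʳ N e (+ 1))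

  ∑-1 : ∑ N (λ _ → + 1 * + 1) ≡ + N
  ∑-1 = trans (∑-const N (+ 1)) (ℤ.*-identityʳ (+ N))

  SameClass₁ : V → V → Set
  SameClass₁ u v = u ≡ v ⊎ Twin₁ u v

  sameClass₁? : ∀ u v → Dec (SameClass₁ u v)
  sameClass₁? u v = (u ≟ v) ⊎-dec twin₁? u v

  sameClass₁-invariant : ∀ u → Stage₁.TwinInvariant (λ v → 𝟙 (sameClass₁? u v))
  sameClass₁-invariant u {a} {b} (a≢e , b≢e , b∈⟨a⟩) = cong (λ c → if c then + 1 else + 0)
    (does-⇔ (mk⇔ to from) (sameClass₁? u a) (sameClass₁? u b))
    where
    a∈⟨b⟩ : a ∈⟨ b ⟩
    a∈⟨b⟩ = ∈⟨⟩-sym b≢e b∈⟨a⟩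
    to : SameClass₁ u a → SameClass₁ u b
    to (inj₁ refl)              = inj₂ (a≢e , b≢e , b∈⟨a⟩)
    to (inj₂ (u≢e , _ , a∈⟨u⟩)) = inj₂ (u≢e , b≢e , ∈⟨⟩-trans b∈⟨a⟩ a∈⟨u⟩)
    from : SameClass₁ u b → SameClass₁ u a
    from (inj₁ refl)              = inj₂ (b≢e , a≢e , a∈⟨b⟩)
    from (inj₂ (u≢e , _ , b∈⟨u⟩)) = inj₂ (u≢e , a≢e , ∈⟨⟩-trans a∈⟨b⟩ b∈⟨u⟩)

  ∑-sameClass₁-e : ∑ N (λ v → 𝟙 (sameClass₁? e v) * + 1) ≡ + 1
  ∑-sameClass₁-e = begin
    ∑ N (λ v → 𝟙 (sameClass₁? e v) * + 1)  ≡⟨ ∑-cong N (λ v → trans (ℤ.*-identityʳ _) (onlyE v)) ⟩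
    ∑ N (λ v → δ e v (+ 1))                 ≡⟨ ∑-δˡ N e (+ 1) ⟩
    + 1                                     ∎
    where
    open ≡-Reasoning
    onlyE : ∀ v → 𝟙 (sameClass₁? e v) ≡ δ e v (+ 1)
    onlyE v = cong (λ c → if c then + 1 else + 0) (does-⇔
      (mk⇔ (λ { (inj₁ e≡v) → e≡v ; (inj₂ (e≢e , _)) → contradiction refl e≢e }) inj₁) (sameClass₁? e v) (e ≟ v))

  ∑-sameClass₁-≢e : ∀ {u} → ¬ u ≡ e → ∑ N (λ v → 𝟙 (sameClass₁? u v) * + 1) ≡ + q
  ∑-sameClass₁-≢e {u} u≢e = begin
    ∑ N (λ v → 𝟙 (sameClass₁? u v) * + 1)                   ≡⟨ ∑-cong N (λ v → trans (ℤ.*-identityʳ _) (line v)) ⟩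
    ∑ N (λ v → 𝟙 (v ∈?⟨ u ⟩) - δ v e (+ 1))                  ≡⟨ ∑-distrib-minus N (λ v → 𝟙 (v ∈?⟨ u ⟩)) (λ v → δ v e (+ 1)) ⟩
    ∑ N (λ v → 𝟙 (v ∈?⟨ u ⟩)) - ∑ N (λ v → δ v e (+ 1))      ≡⟨ cong₂ _-_ (∣⟨⟩∣≡p u≢e) (∑-δʳ N e (+ 1)) ⟩
    + p - + 1                                                ≡⟨ cong (_- + 1) q+1≡p ⟨
    + q + + 1 - + 1                                          ≡⟨ cancel (+ q) ⟩
    + q                                                      ∎
    where
    open ≡-Reasoning
    cancel : ∀ a → a + + 1 - + 1 ≡ a
    cancel = solve-∀
    sameClass⇔ : ∀ {v} → SameClass₁ u v ⇔ (v ∈⟨ u ⟩ × ¬ v ≡ e)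
    sameClass⇔ = mk⇔ (λ { (inj₁ refl) → ∈⟨⟩-refl u , u≢e ; (inj₂ (_ , v≢e , v∈⟨u⟩)) → v∈⟨u⟩ , v≢e })
                     (λ { (v∈⟨u⟩ , v≢e) → inj₂ (u≢e , v≢e , v∈⟨u⟩) })
    line : ∀ v → 𝟙 (sameClass₁? u v) ≡ 𝟙 (v ∈?⟨ u ⟩) - δ v e (+ 1)
    line v = trans (cong (λ c → if c then + 1 else + 0) (does-⇔ sameClass⇔ (sameClass₁? u v) (v ∈?⟨ u ⟩ ×-dec ¬? (v ≟ e))))
                   (𝟙-×-¬ (v ∈?⟨ u ⟩) (v ≟ e) (λ { refl → e∈⟨⟩ u }))

  ∑-sameClass₁ : ∀ u → ∑ N (λ v → 𝟙 (sameClass₁? u v) * + 1) ≡ classSize u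
  ∑-sameClass₁ = by-e (trans ∑-sameClass₁-e (sym if-e)) (λ u≢e → trans (∑-sameClass₁-≢e u≢e) (sym (if-≢e u≢e)))

  -- Stage 1 merges each cyclic subgroup minus the identity into one class of weight p − 1.
  R₁ : Stage₁.Reduced N id (λ _ → + 1)
  R₁ = Stage₁.reduce N id (λ _ → + 1)

  open Stage₁.Reduced R₁ renaming
    ( classes to k₁ ; merges to m₁ ; k≡merges+classes to N≡m₁+k₁ ; rep to rep₁ ; weight to weight₁
    ; rep-twinFree to rep₁-twinFree ; rep-injective to rep₁-injective′ ; det-quotient to det-quotient₁
    ; weightedSum to weightedSum₁ )

  rep₁-injective : Injective _≡_ _≡_ rep₁
  rep₁-injective = rep₁-injective′ id

  weight₁≡classSize : ∀ i → weight₁ i ≡ classSize (rep₁ i)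
  weight₁≡classSize i = begin
      weight₁ i
    ≡⟨ ℤ.*-identityˡ (weight₁ i) ⟨
      + 1 * weight₁ i
    ≡⟨ cong (_* weight₁ i) (𝟙-yes (sameClass₁? (rep₁ i) (rep₁ i)) (inj₁ refl)) ⟨
      𝟙 (sameClass₁? (rep₁ i) (rep₁ i)) * weight₁ i
    ≡⟨ ∑-single k₁ (λ j → 𝟙 (sameClass₁? (rep₁ i) (rep₁ j)) * weight₁ j) i otherClass ⟨
      ∑ k₁ (λ j → 𝟙 (sameClass₁? (rep₁ i) (rep₁ j)) * weight₁ j)
    ≡⟨ weightedSum₁ (λ v → 𝟙 (sameClass₁? (rep₁ i) v)) (sameClass₁-invariant (rep₁ i)) ⟩
      ∑ N (λ v → 𝟙 (sameClass₁? (rep₁ i) v) * + 1)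
    ≡⟨ ∑-sameClass₁ (rep₁ i) ⟩
      classSize (rep₁ i)
    ∎
    where
    open ≡-Reasoning
    otherClass : ∀ j → ¬ j ≡ i → 𝟙 (sameClass₁? (rep₁ i) (rep₁ j)) * weight₁ j ≡ + 0
    otherClass j j≢i = trans (cong (_* weight₁ j) (𝟙-no (sameClass₁? (rep₁ i) (rep₁ j)) distinct)) (ℤ.*-zeroˡ (weight₁ j))
      where
      distinct : ¬ SameClass₁ (rep₁ i) (rep₁ j)
      distinct (inj₁ same) = j≢i (sym (rep₁-injective same))
      distinct (inj₂ twin) = rep₁-twinFree i j (j≢i ∘ sym) twin

  e-index₁ : ∃[ i ] rep₁ i ≡ e
  e-index₁ = e-index rep₁ weight₁ (trans (weightedSum₁ (λ v → 𝟙 (v ≟ e)) 𝟙e-invariant₁) ∑-𝟙e)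

  -- The weights p − 1 of the classes other than {e} add up to p³ − 1 = (p² + p + 1)(p − 1).
  classCount : ∀ k (σ : Fin k → V) (ω : Fin k → ℤ) → Injective _≡_ _≡_ σ → (∀ i → ω i ≡ classSize (σ i)) →
    ∃[ i ] σ i ≡ e → ∑ k (λ j → + 1 * ω j) ≡ + N → k ≡ p ℕ.* p ℕ.+ p ℕ.+ 2
  classCount (suc k) σ ω σ-injective ω≡classSize (i , σi≡e) total =
    trans (cong suc (ℕ.*-cancelʳ-≡ k (p ℕ.* p ℕ.+ p ℕ.+ 1) q (ℕ.+-cancelˡ-≡ 1 _ _ (trans (sym N≡1+kq) N≡1+[p²+p+1]q))))
          (sym (ℕ.+-suc (p ℕ.* p ℕ.+ p) 1))
    where
    open ≡-Reasoning
    weight-i : + 1 * ω i ≡ + 1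
    weight-i = trans (ℤ.*-identityˡ (ω i)) (trans (ω≡classSize i) (trans (cong classSize σi≡e) if-e))
    weight-other : ∀ j → + 1 * ω (punchIn i j) ≡ + q
    weight-other j = trans (ℤ.*-identityˡ _) (trans (ω≡classSize (punchIn i j)) (if-≢e σj≢e))
      where
      σj≢e : ¬ σ (punchIn i j) ≡ e
      σj≢e σj≡e = punchInᵢ≢i i j (σ-injective (trans σj≡e (sym σi≡e)))
    N≡1+kq : N ≡ 1 ℕ.+ k ℕ.* q
    N≡1+kq = ℤ.+-injective (begin
      + N                                                  ≡⟨ total ⟨
      ∑ (suc k) (λ j → + 1 * ω j)                          ≡⟨ ∑-remove k (λ j → + 1 * ω j) i ⟩
      + 1 * ω i + ∑ k (λ j → + 1 * ω (punchIn i j))        ≡⟨ cong₂ _+_ weight-i (∑-cong k weight-other) ⟩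
      + 1 + ∑ k (λ _ → + q)                                ≡⟨ cong (_+_ (+ 1)) (trans (∑-const k (+ q)) (sym (ℤ.pos-* k q))) ⟩
      + 1 + + (k ℕ.* q)                                    ≡⟨ ℤ.pos-+ 1 (k ℕ.* q) ⟨
      + (1 ℕ.+ k ℕ.* q)                                    ∎)
    N≡1+[p²+p+1]q : N ≡ 1 ℕ.+ (p ℕ.* p ℕ.+ p ℕ.+ 1) ℕ.* q
    N≡1+[p²+p+1]q = subst (λ r → r ℕ.* r ℕ.* r ≡ 1 ℕ.+ (r ℕ.* r ℕ.+ r ℕ.+ 1) ℕ.* q) (ℕ.suc-pred p) (cube q)
      where
      cube : ∀ q → suc q ℕ.* suc q ℕ.* suc q ≡ 1 ℕ.+ (suc q ℕ.* suc q ℕ.+ suc q ℕ.+ 1) ℕ.* q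
      cube = ℕSolver.solve-∀

  k₁≡p²+p+2 : k₁ ≡ p ℕ.* p ℕ.+ p ℕ.+ 2
  k₁≡p²+p+2 = classCount k₁ rep₁ weight₁ rep₁-injective weight₁≡classSize e-index₁
    (trans (weightedSum₁ (λ _ → + 1) (λ _ → refl)) ∑-1)

  -- On the stage-1 representatives F₁ and F₂ differ only on non-identity diagonal entries, by 1;
  -- with weight p − 1 this is exactly α₁ − α₂.
  F₁≡F₂ : ∀ {u v} → ¬ Twin₁ u v → F₁ u v ≡ F₂ u v
  F₁≡F₂ {u} {v} ¬twin = cases (u ≟ e) (v ≟ e)
    where
    cases : Dec (u ≡ e) → Dec (v ≡ e) → F₁ u v ≡ F₂ u v
    cases (yes refl) _          = trans (cong +_ (closedDist-comparable (e-comparable v))) (sym if-e)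
    cases (no u≢e)   (yes refl) = trans (cong +_ (closedDist-comparable (inj₂ (e∈⟨⟩ u)))) (sym (trans (if-≢e u≢e) if-e))
    cases (no u≢e)   (no v≢e)   = trans (cong +_ (closedDist-incomparable incomparable)) (sym (trans (if-≢e u≢e) (if-≢e v≢e)))
      where
      incomparable : ¬ Comparable u v
      incomparable (inj₁ u∈⟨v⟩) = ¬twin (u≢e , v≢e , ∈⟨⟩-sym u≢e u∈⟨v⟩)
      incomparable (inj₂ v∈⟨u⟩) = ¬twin (u≢e , v≢e , v∈⟨u⟩)

  diagonal₁≡₂ : ∀ v → A₁ v + F₁ v v * classSize v ≡ A₂ v + F₂ v v * classSize v
  diagonal₁≡₂ = by-e
    (cong₂ (λ a f → a + f * classSize e) (trans if-e (sym if-e)) (trans (cong +_ (closedDist-refl e)) (sym if-e)))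
    (λ {v} v≢e → begin
      A₁ v + F₁ v v * classSize v     ≡⟨ cong₂ (λ a k → a + + k * classSize v) (if-≢e v≢e) (closedDist-refl v) ⟩
      α₁ + + 1 * classSize v          ≡⟨ cong (λ w → α₁ + + 1 * w) (if-≢e v≢e) ⟩
      α₁ + + 1 * + q                  ≡⟨ cong (λ r → x - + 2 * + N + r + + 1 * + q) q+1≡p ⟨
      x - + 2 * + N + (+ q + + 1) + + 1 * + q ≡⟨ regroup x (+ N) (+ q) ⟩
      α₂ + + 2 * + q                  ≡⟨ cong₂ (λ a f → a + f * + q) (if-≢e v≢e) (trans (if-≢e v≢e) (if-≢e v≢e)) ⟨
      A₂ v + F₂ v v * + q             ≡⟨ cong (λ w → A₂ v + F₂ v v * w) (if-≢e v≢e) ⟨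
      A₂ v + F₂ v v * classSize v     ∎)
    where
    open ≡-Reasoning
    regroup : ∀ x n q → x - + 2 * n + (q + + 1) + + 1 * q ≡ x - + 2 * n + + 1 + + 2 * q
    regroup = solve-∀

  quotient₁≗quotient₂ : ∀ i j → quotient A₁ F₁ rep₁ weight₁ i j ≡ quotient A₂ F₂ rep₁ weight₁ i j
  quotient₁≗quotient₂ i j with i ≟ j
  ... | yes refl = begin
    A₁ (rep₁ i) + F₁ (rep₁ i) (rep₁ i) * weight₁ i           ≡⟨ cong (λ w → A₁ (rep₁ i) + F₁ (rep₁ i) (rep₁ i) * w) (weight₁≡classSize i) ⟩
    A₁ (rep₁ i) + F₁ (rep₁ i) (rep₁ i) * classSize (rep₁ i)  ≡⟨ diagonal₁≡₂ (rep₁ i) ⟩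
    A₂ (rep₁ i) + F₂ (rep₁ i) (rep₁ i) * classSize (rep₁ i)  ≡⟨ cong (λ w → A₂ (rep₁ i) + F₂ (rep₁ i) (rep₁ i) * w) (weight₁≡classSize i) ⟨
    A₂ (rep₁ i) + F₂ (rep₁ i) (rep₁ i) * weight₁ i           ∎
    where open ≡-Reasoning
  ... | no i≢j = cong (λ f → + 0 + f * weight₁ j) (F₁≡F₂ (rep₁-twinFree i j i≢j))

  R₂ : Stage₂.Reduced k₁ rep₁ weight₁
  R₂ = Stage₂.reduce k₁ rep₁ weight₁

  open Stage₂.Reduced R₂ renaming
    ( classes to k₂ ; merges to m₂ ; k≡merges+classes to k₁≡m₂+k₂ ; rep to rep₂ ; weight to weight₂
    ; rep-twinFree to rep₂-twinFree ; rep-injective to rep₂-injective′ ; det-quotient to det-quotient₂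
    ; weightedSum to weightedSum₂ )

  det-twoClasses : ∀ (σ : Fin 2 → V) ω → σ zero ≡ e → ¬ σ (suc zero) ≡ e →
    ω zero ≡ + 1 → ω (suc zero) ≡ + N - + 1 → det 2 (quotient A₂ F₂ σ ω) ≡ x * (x - + N)
  det-twoClasses σ ω σ₀≡e σ₁≢e ω₀≡1 ω₁≡N-1 = begin
      det 2 (quotient A₂ F₂ σ ω)
    ≡⟨ det₂ (quotient A₂ F₂ σ ω) ⟩
      (A₂ σ₀ + F₂ σ₀ σ₀ * ω₀) * (A₂ σ₁ + F₂ σ₁ σ₁ * ω₁) - (+ 0 + F₂ σ₀ σ₁ * ω₁) * (+ 0 + F₂ σ₁ σ₀ * ω₀)
    ≡⟨ cong₂ _-_ (cong₂ _*_ (cong₂ (λ a f → a + f * ω₀) A₂σ₀ F₂σ₀σ₀) (cong₂ (λ a f → a + f * ω₁) (if-≢e σ₁≢e) F₂σ₁σ₁))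
                 (cong₂ _*_ (cong (λ f → + 0 + f * ω₁) F₂σ₀σ₁) (cong (λ f → + 0 + f * ω₀) F₂σ₁σ₀)) ⟩
      (x - + N + + 1 * ω₀) * (α₂ + + 2 * ω₁) - (+ 0 + + 1 * ω₁) * (+ 0 + + 1 * ω₀)
    ≡⟨ cong₂ (λ a b → (x - + N + + 1 * a) * (α₂ + + 2 * b) - (+ 0 + + 1 * b) * (+ 0 + + 1 * a)) ω₀≡1 ω₁≡N-1 ⟩
      (x - + N + + 1 * + 1) * (α₂ + + 2 * (+ N - + 1)) - (+ 0 + + 1 * (+ N - + 1)) * (+ 0 + + 1 * + 1)
    ≡⟨ expand x (+ N) ⟩
      x * (x - + N)
    ∎
    where
    open ≡-Reasoning
    σ₀ σ₁ : V
    σ₀ = σ zero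
    σ₁ = σ (suc zero)
    ω₀ ω₁ : ℤ
    ω₀ = ω zero
    ω₁ = ω (suc zero)
    A₂σ₀ : A₂ σ₀ ≡ x - + N
    A₂σ₀ = trans (cong A₂ σ₀≡e) if-e
    F₂σ₀σ₀ : F₂ σ₀ σ₀ ≡ + 1
    F₂σ₀σ₀ = trans (cong (λ v → F₂ v v) σ₀≡e) if-e
    F₂σ₁σ₁ : F₂ σ₁ σ₁ ≡ + 2
    F₂σ₁σ₁ = trans (if-≢e σ₁≢e) (if-≢e σ₁≢e)
    F₂σ₀σ₁ : F₂ σ₀ σ₁ ≡ + 1
    F₂σ₀σ₁ = trans (cong (λ v → F₂ v σ₁) σ₀≡e) if-e
    F₂σ₁σ₀ : F₂ σ₁ σ₀ ≡ + 1
    F₂σ₁σ₀ = trans (if-≢e σ₁≢e) (trans (cong (λ v → if does (v ≟ e) then + 1 else + 2) σ₀≡e) if-e)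
    expand : ∀ x n → (x - n + + 1 * + 1) * (x - + 2 * n + + 1 + + 2 * (n - + 1)) - (+ 0 + + 1 * (n - + 1)) * (+ 0 + + 1 * + 1)
                     ≡ x * (x - n)
    expand = solve-∀

  -- With the identity's class in front, twin-freeness leaves room for exactly one more class.
  twoClasses-front : ∀ k (σ : Fin (suc k) → V) ω → Injective _≡_ _≡_ σ → Stage₂.TwinFree σ → σ zero ≡ e →
    ∑ (suc k) (λ j → 𝟙 (σ j ≟ e) * ω j) ≡ + 1 → ∑ (suc k) (λ j → + 1 * ω j) ≡ + N →
    suc k ≡ 2 × det (suc k) (quotient A₂ F₂ σ ω) ≡ x * (x - + N)
  twoClasses-front zero σ ω _ _ σ₀≡e ∑e ∑all = contradiction N≡1 (ℕ.<⇒≢ 1<N ∘ sym)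
    where
    N≡1 : N ≡ 1
    N≡1 = ℤ.+-injective (begin
      + N                             ≡⟨ ∑all ⟨
      + 1 * ω zero + + 0              ≡⟨ cong (λ a → a * ω zero + + 0) (𝟙-yes (σ zero ≟ e) σ₀≡e) ⟨
      𝟙 (σ zero ≟ e) * ω zero + + 0   ≡⟨ ∑e ⟩
      + 1                             ∎)
      where open ≡-Reasoning
    1<N : 1 ℕ.< N
    1<N = ℕ.<-≤-trans 1<p (ℕ.≤-trans (ℕ.m≤m*n p p) (ℕ.m≤m*n (p ℕ.* p) p))
  twoClasses-front (suc (suc k)) σ ω σ-injective twinFree σ₀≡e _ _ =
    contradiction (≢e (suc zero) (λ ()) , ≢e (suc (suc zero)) (λ ())) (twinFree (suc zero) (suc (suc zero)) (λ ()))
    where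
    ≢e : ∀ i → ¬ i ≡ zero → ¬ σ i ≡ e
    ≢e i i≢0 σi≡e = i≢0 (σ-injective (trans σi≡e (sym σ₀≡e)))
  twoClasses-front (suc zero) σ ω σ-injective _ σ₀≡e ∑e ∑all =
    refl , det-twoClasses σ ω σ₀≡e σ₁≢e ω₀≡1 ω₁≡N-1
    where
    σ₁≢e : ¬ σ (suc zero) ≡ e
    σ₁≢e σ₁≡e with σ-injective (trans σ₁≡e (sym σ₀≡e))
    ... | ()
    ω₀≡1 : ω zero ≡ + 1
    ω₀≡1 = trans (select (ω zero) (ω (suc zero))) (trans (cong₂ (λ a b → a * ω zero + (b * ω (suc zero) + + 0))
      (sym (𝟙-yes (σ zero ≟ e) σ₀≡e)) (sym (𝟙-no (σ (suc zero) ≟ e) σ₁≢e))) ∑e)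
      where select : ∀ a b → a ≡ + 1 * a + (+ 0 * b + + 0)
            select = solve-∀
    ω₁≡N-1 : ω (suc zero) ≡ + N - + 1
    ω₁≡N-1 = trans (isolate (ω zero) (ω (suc zero))) (cong₂ (λ t a → t - + 1 * a) ∑all ω₀≡1)
      where isolate : ∀ a b → b ≡ (+ 1 * a + (+ 1 * b + + 0)) - + 1 * a
            isolate = solve-∀

  twoClasses : ∀ k (σ : Fin k → V) ω → Injective _≡_ _≡_ σ → Stage₂.TwinFree σ →
    ∑ k (λ j → 𝟙 (σ j ≟ e) * ω j) ≡ + 1 → ∑ k (λ j → + 1 * ω j) ≡ + N →
    k ≡ 2 × det k (quotient A₂ F₂ σ ω) ≡ x * (x - + N)
  twoClasses zero    σ ω _           _        ∑e _    = contradiction ∑e λ ()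
  twoClasses (suc k) σ ω σ-injective twinFree ∑e ∑all with e-index σ ω ∑e
  ... | i , σi≡e = Data.Product.Base.map₂ (trans (sym (det-quotient-toFront A₂ F₂ k σ ω i)))
    (twoClasses-front k (σ ∘ toFront i) (ω ∘ toFront i)
      (toFront-injective i ∘ σ-injective)
      (λ a b a≢b → twinFree (toFront i a) (toFront i b) (a≢b ∘ toFront-injective i))
      σi≡e
      (trans (∑-toFront k (λ j → 𝟙 (σ j ≟ e) * ω j) i) ∑e)
      (trans (∑-toFront k (λ j → + 1 * ω j) i) ∑all))

  k₂≡2×det : k₂ ≡ 2 × det k₂ (quotient A₂ F₂ rep₂ weight₂) ≡ x * (x - + N)
  k₂≡2×det = twoClasses k₂ rep₂ weight₂ (rep₂-injective′ rep₁-injective) rep₂-twinFree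
    (trans (weightedSum₂ (λ v → 𝟙 (v ≟ e)) 𝟙e-invariant₂) (trans (weightedSum₁ (λ v → 𝟙 (v ≟ e)) 𝟙e-invariant₁) ∑-𝟙e))
    (trans (weightedSum₂ (λ _ → + 1) (λ _ → refl)) (trans (weightedSum₁ (λ _ → + 1) (λ _ → refl)) ∑-1))

  m₁≡ : m₁ ≡ N ℕ.∸ p ℕ.* p ℕ.∸ p ℕ.∸ 2
  m₁≡ = begin
    m₁                                    ≡⟨ ℕ.m+n∸n≡m m₁ k₁ ⟨
    m₁ ℕ.+ k₁ ℕ.∸ k₁                      ≡⟨ cong₂ ℕ._∸_ (sym N≡m₁+k₁) k₁≡p²+p+2 ⟩
    N ℕ.∸ (p ℕ.* p ℕ.+ p ℕ.+ 2)           ≡⟨ cong (N ℕ.∸_) (ℕ.+-assoc (p ℕ.* p) p 2) ⟩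
    N ℕ.∸ (p ℕ.* p ℕ.+ (p ℕ.+ 2))         ≡⟨ ℕ.∸-+-assoc N (p ℕ.* p) (p ℕ.+ 2) ⟨
    N ℕ.∸ p ℕ.* p ℕ.∸ (p ℕ.+ 2)           ≡⟨ ℕ.∸-+-assoc (N ℕ.∸ p ℕ.* p) p 2 ⟨
    N ℕ.∸ p ℕ.* p ℕ.∸ p ℕ.∸ 2             ∎
    where open ≡-Reasoning

  m₂≡ : m₂ ≡ p ℕ.* p ℕ.+ p
  m₂≡ = ℕ.+-cancelʳ-≡ 2 m₂ (p ℕ.* p ℕ.+ p)
    (trans (cong (m₂ ℕ.+_) (sym (proj₁ k₂≡2×det))) (trans (sym k₁≡m₂+k₂) k₁≡p²+p+2))

  det-quotient₁-factorisation : det N (quotient A₁ F₁ id (λ _ → + 1)) ≡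
    α₁ ^ (N ℕ.∸ p ℕ.* p ℕ.∸ p ℕ.∸ 2) * (α₂ ^ (p ℕ.* p ℕ.+ p) * (x * (x - + N)))
  det-quotient₁-factorisation = begin
      det N (quotient A₁ F₁ id (λ _ → + 1))
    ≡⟨ det-quotient₁ ⟩
      α₁ ^ m₁ * det k₁ (quotient A₁ F₁ rep₁ weight₁)
    ≡⟨ cong (α₁ ^ m₁ *_) (det-cong k₁ quotient₁≗quotient₂) ⟩
      α₁ ^ m₁ * det k₁ (quotient A₂ F₂ rep₁ weight₁)
    ≡⟨ cong (α₁ ^ m₁ *_) det-quotient₂ ⟩
      α₁ ^ m₁ * (α₂ ^ m₂ * det k₂ (quotient A₂ F₂ rep₂ weight₂))
    ≡⟨ cong (λ t → α₁ ^ m₁ * (α₂ ^ m₂ * t)) (proj₂ k₂≡2×det) ⟩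
      α₁ ^ m₁ * (α₂ ^ m₂ * (x * (x - + N)))
    ≡⟨ cong₂ (λ a b → α₁ ^ a * (α₂ ^ b * (x * (x - + N)))) m₁≡ m₂≡ ⟩
      α₁ ^ (N ℕ.∸ p ℕ.* p ℕ.∸ p ℕ.∸ 2) * (α₂ ^ (p ℕ.* p ℕ.+ p) * (x * (x - + N)))
    ∎
    where open ≡-Reasoning

open import Data.Integer.Base using (+_; _-_; _*_; _^_)
open import Data.Integer.Tactic.RingSolver using (solve-∀)
open import Function.Base using (id)
open import Relation.Binary.PropositionalEquality using (module ≡-Reasoning)
open Determinant using (det-cong)
open QuotientMatrix using (quotient)

theorem2p8 : (p : ℕ) (pr : Prime p) →
    let open PowerGraph p {{prime⇒nonZero pr}} in
    (d : Fin N → Fin N → ℕ) → IsDistance d →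
    (x : ℤ) → det N (charMat d x) ≡ claimedPoly p x
theorem2p8 p pr d d-isDistance x = begin
    det N (charMat d x)
  ≡⟨ det-cong N (charMat≗quotient₁ d-isDistance) ⟩
    det N (quotient A₁ F₁ id (λ _ → + 1))
  ≡⟨ det-quotient₁-factorisation ⟩
    α₁ ^ (N ℕ.∸ p ℕ.* p ℕ.∸ p ℕ.∸ 2) * (α₂ ^ (p ℕ.* p ℕ.+ p) * (x * (x - + N)))
  ≡⟨ reorder (α₁ ^ (N ℕ.∸ p ℕ.* p ℕ.∸ p ℕ.∸ 2)) (α₂ ^ (p ℕ.* p ℕ.+ p)) (x * (x - + N)) ⟩
    claimedPoly p x
  ∎
  where
  open PowerGraph p {{prime⇒nonZero pr}} using (N; charMat)
  open Spectrum p pr x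
  open ≡-Reasoning
  import Data.Nat.Base as ℕ
  reorder : ∀ a b c → a * (b * c) ≡ c * b * a
  reorder = solve-∀
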